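{- Let $f(x)=\dfrac{x}{1-6x+x^2}$. For every integer $r\ge 2$, $$ f(x)^r=\frac{x^{2 r-2}f^{(r-1)}(x)}{(r-1)!\,(1-x^2)^{r-1}}+\sum_{k=1}^{r-2}\frac{\sum_{j=0}^{k-1}\binom{k}{j}\binom{r-2}{k-j-1}x^{2 r-k+2 j-2}}{k\,(r-k-2)!\,(1-x^2)^{r+k-1}}\,f^{(r-k-1)}(x)\,, $$ where $f^{(m)}$ denotes the $m$-th derivative of $f$ (and the sum over $k$ is empty when $r=2$).
   Context: $f(x)=\sum_{n\ge 0}B_nx^n$ is the generating function of the balancing numbers $B_n$ ($B_0=0$, $B_1=1$, $B_n=6B_{n-1}-B_{n-2}$ for $n\ge2$); the identity is between rational functions (equivalently formal power series). -}

module Defs where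

open import Data.Nat as ℕ using (ℕ; zero; suc; _∸_; _!)
open import Data.Nat.Combinatorics using (_C_)
open import Relation.Nullary using (yes; no)
open import Data.Integer using (+_)
open import Data.Rational using (ℚ; 0ℚ; 1ℚ; _/_; _+_; _-_; _*_; -_)
open import Data.List using (List; []; _∷_; map; foldr; upTo)
open import Relation.Binary.PropositionalEquality using (_≡_)

ℕ→ℚ : ℕ → ℚ
ℕ→ℚ n = + n / 1

-- reciprocal 1/n of a natural number (only ever applied to n ≥ 1 below;
-- the value at 0 is an irrelevant junk value 0)
recipℕ : ℕ → ℚ
recipℕ zero = 0ℚ
recipℕ (suc n) = + 1 / suc n

-- Formal power series over ℚ: the coefficient sequence
Series : Set
Series = ℕ → ℚ

_≈ₛ_ : Series → Series → Set
s ≈ₛ t = ∀ n → s n ≡ t n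

infix 4 _≈ₛ_

zeroₛ : Series
zeroₛ _ = 0ℚ

oneₛ : Series
oneₛ zero = 1ℚ
oneₛ (suc _) = 0ℚ

_+ₛ_ : Series → Series → Series
(s +ₛ t) n = s n + t n

_·ₛ_ : ℚ → Series → Series
(c ·ₛ s) n = c * s n

sumℚ : List ℚ → ℚ
sumℚ = foldr _+_ 0ℚ

_*ₛ_ : Series → Series → Series
(s *ₛ t) n = sumℚ (map (λ i → s i * t (n ∸ i)) (upTo (suc n)))

_^ₛ_ : Series → ℕ → Series
s ^ₛ zero = oneₛ
s ^ₛ suc m = s *ₛ (s ^ₛ m)

sumₛ : List Series → Series
sumₛ = foldr _+ₛ_ zeroₛ

xpow : ℕ → Series
xpow k n with k ℕ.≟ n
... | yes _ = 1ℚ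
... | no _ = 0ℚ

deriv : Series → Series
deriv s n = ℕ→ℚ (suc n) * s (suc n)

derivⁿ : ℕ → Series → Series
derivⁿ zero s = s
derivⁿ (suc m) s = deriv (derivⁿ m s)

oneMinusX² : Series
oneMinusX² zero = 1ℚ
oneMinusX² (suc zero) = 0ℚ
oneMinusX² (suc (suc zero)) = - 1ℚ
oneMinusX² (suc (suc (suc _))) = 0ℚ

-- 1/(1 - x^2) = Σ_i x^{2i}  (the multiplicative inverse of 1 - x^2)
invOneMinusX² : Series
invOneMinusX² zero = 1ℚ
invOneMinusX² (suc zero) = 0ℚ
invOneMinusX² (suc (suc n)) = invOneMinusX² n

B : ℕ → ℚ
B zero = 0ℚ
B (suc zero) = 1ℚ
B (suc (suc n)) = ℕ→ℚ 6 * B (suc n) - B n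

-- f(x) = x/(1-6x+x^2) = Σ Bₙ xⁿ
f : Series
f = B

firstTerm : ℕ → Series
firstTerm r =
  recipℕ ((r ∸ 1) !) ·ₛ
    (xpow (2 ℕ.* r ∸ 2) *ₛ (derivⁿ (r ∸ 1) f *ₛ (invOneMinusX² ^ₛ (r ∸ 1))))

numer : ℕ → ℕ → Series
numer r k = sumₛ (map (λ j → ℕ→ℚ ((k C j) ℕ.* ((r ∸ 2) C (k ∸ j ∸ 1)))
                          ·ₛ xpow ((2 ℕ.* r ℕ.+ 2 ℕ.* j) ∸ (k ℕ.+ 2)))
                      (upTo k))

kthTerm : ℕ → ℕ → Series
kthTerm r k =
  recipℕ (k ℕ.* (r ∸ k ∸ 2) !) ·ₛ
    (numer r k *ₛ ((invOneMinusX² ^ₛ (r ℕ.+ k ∸ 1)) *ₛ derivⁿ (r ∸ k ∸ 1) f))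

rhs : ℕ → Series
rhs r = firstTerm r +ₛ sumₛ (map (λ i → kthTerm r (suc i)) (upTo (r ∸ 2)))

module Submission where

-- Write D = 1 - 6x + x², P = 1/(1 - x²) and U = x² P.  From D f = x one gets
-- D² f' = 1 - x², hence f² = U f' (multiplied by D² both sides become x², and D
-- cancels), and therefore f^{n+2} = U (f^{n+1})' / (n+1).  The normal form of
-- f^{n+1} is Σ_{k,j ≤ n} c(n,k,j) x^{2n+2j-k} P^{n+k} f^{(n-k)} with explicit
-- rational coefficients c.  As U (x^a P^b G)' is a combination of three monomials
-- of the same shape, U (normal form of f^{n+1})' = (n+1) (normal form of f^{n+2})
-- reduces to a recurrence for c, i.e. to a polynomial identity between binomial
-- coefficients that follows from the absorption identity.  By induction f^{n+1}
-- equals its normal form, which for n = r - 1 is the right-hand side of the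
-- statement.

open import Defs renaming (_+ₛ_ to infixl 6 _+ₛ_; _*ₛ_ to infixl 7 _*ₛ_; _^ₛ_ to infixr 8 _^ₛ_; _·ₛ_ to infixr 8 _·ₛ_)
open import Data.Nat as ℕ using (ℕ; zero; suc; _≤_; _<_; _∸_; z≤n; s≤s; _!)
import Data.Nat.Properties as ℕP
import Data.Nat.Solver
open import Data.Nat.Combinatorics using (_C_; nCk+nC[k+1]≡[n+1]C[k+1])
import Data.Integer as ℤ
import Data.Integer.Properties as ℤP
open import Data.Rational as ℚ using (ℚ; 0ℚ; 1ℚ; _+_; _*_; _-_; -_; toℚᵘ)
import Data.Rational.Unnormalised as ℚᵘ
import Data.Rational.Unnormalised.Properties as ℚᵘP
import Data.Rational.Properties as ℚP
open import Data.Rational.Solver using (module +-*-Solver)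
open import Data.List using (_∷_; map; applyUpTo)
open import Data.Product using (_×_; _,_; proj₁)
open import Data.Maybe using (Maybe; just; nothing)
open import Data.Empty using (⊥-elim)
open import Function using (_∘_)
open import Relation.Nullary using (Dec; yes; no; ¬_)
open import Relation.Binary.PropositionalEquality
open import Algebra.Bundles using (CommutativeRing)
open import Level using (0ℓ)
import Algebra.Solver.Ring as RingSolver
import Algebra.Solver.Ring.AlmostCommutativeRing as ACR
import Relation.Binary.Reasoning.Setoid

module ℚS = +-*-Solver
module ℕS = Data.Nat.Solver.+-*-Solver

-- The embedding ℕ → ℚ is a semiring homomorphism, and recipℕ inverts it on
-- positive numbers.  Both are checked on unnormalised rationals, where the
-- arithmetic is plain integer arithmetic.

toℚᵘ-ℕ→ℚ : ∀ n → toℚᵘ (ℕ→ℚ n) ℚᵘ.≃ ℚᵘ.mkℚᵘ (ℤ.+ n) 0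
toℚᵘ-ℕ→ℚ n = ℚP.toℚᵘ-fromℚᵘ (ℚᵘ.mkℚᵘ (ℤ.+ n) 0)

ℕ→ℚ-+ : ∀ a b → ℕ→ℚ (a ℕ.+ b) ≡ ℕ→ℚ a + ℕ→ℚ b
ℕ→ℚ-+ a b = ℚP.toℚᵘ-injective (begin
    toℚᵘ (ℕ→ℚ (a ℕ.+ b))                         ≈⟨ toℚᵘ-ℕ→ℚ (a ℕ.+ b) ⟩
    ℚᵘ.mkℚᵘ (ℤ.+ (a ℕ.+ b)) 0                   ≈⟨ ℚᵘ.*≡* integral ⟩
    ℚᵘ.mkℚᵘ (ℤ.+ a) 0 ℚᵘ.+ ℚᵘ.mkℚᵘ (ℤ.+ b) 0    ≈⟨ ℚᵘP.+-cong (toℚᵘ-ℕ→ℚ a) (toℚᵘ-ℕ→ℚ b) ⟨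
    toℚᵘ (ℕ→ℚ a) ℚᵘ.+ toℚᵘ (ℕ→ℚ b)              ≈⟨ ℚP.toℚᵘ-homo-+ (ℕ→ℚ a) (ℕ→ℚ b) ⟨
    toℚᵘ (ℕ→ℚ a + ℕ→ℚ b)                        ∎)
  where
  open import Relation.Binary.Reasoning.Setoid ℚᵘP.≃-setoid
  integral : ℤ.+ (a ℕ.+ b) ℤ.* ℤ.+ 1 ≡ (ℤ.+ a ℤ.* ℤ.+ 1 ℤ.+ ℤ.+ b ℤ.* ℤ.+ 1) ℤ.* ℤ.+ 1
  integral = cong (ℤ._* ℤ.+ 1) (sym (cong₂ ℤ._+_ (ℤP.*-identityʳ (ℤ.+ a)) (ℤP.*-identityʳ (ℤ.+ b))))

ℕ→ℚ-* : ∀ a b → ℕ→ℚ (a ℕ.* b) ≡ ℕ→ℚ a * ℕ→ℚ b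
ℕ→ℚ-* a b = ℚP.toℚᵘ-injective (begin
    toℚᵘ (ℕ→ℚ (a ℕ.* b))                         ≈⟨ toℚᵘ-ℕ→ℚ (a ℕ.* b) ⟩
    ℚᵘ.mkℚᵘ (ℤ.+ (a ℕ.* b)) 0                   ≈⟨ ℚᵘ.*≡* (cong (ℤ._* ℤ.+ 1) (ℤP.pos-* a b)) ⟩
    ℚᵘ.mkℚᵘ (ℤ.+ a) 0 ℚᵘ.* ℚᵘ.mkℚᵘ (ℤ.+ b) 0    ≈⟨ ℚᵘP.*-cong (toℚᵘ-ℕ→ℚ a) (toℚᵘ-ℕ→ℚ b) ⟨
    toℚᵘ (ℕ→ℚ a) ℚᵘ.* toℚᵘ (ℕ→ℚ b)              ≈⟨ ℚP.toℚᵘ-homo-* (ℕ→ℚ a) (ℕ→ℚ b) ⟨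
    toℚᵘ (ℕ→ℚ a * ℕ→ℚ b)                        ∎)
  where open import Relation.Binary.Reasoning.Setoid ℚᵘP.≃-setoid

ℕ→ℚ-suc : ∀ n → ℕ→ℚ (suc n) ≡ 1ℚ + ℕ→ℚ n
ℕ→ℚ-suc n = ℕ→ℚ-+ 1 n

recipℕ-inverse : ∀ n → recipℕ (suc n) * ℕ→ℚ (suc n) ≡ 1ℚ
recipℕ-inverse n = ℚP.toℚᵘ-injective (begin
    toℚᵘ (recipℕ (suc n) * ℕ→ℚ (suc n))                 ≈⟨ ℚP.toℚᵘ-homo-* (recipℕ (suc n)) (ℕ→ℚ (suc n)) ⟩
    toℚᵘ (recipℕ (suc n)) ℚᵘ.* toℚᵘ (ℕ→ℚ (suc n))       ≈⟨ ℚᵘP.*-cong (ℚP.toℚᵘ-fromℚᵘ (ℚᵘ.mkℚᵘ (ℤ.+ 1) n)) (toℚᵘ-ℕ→ℚ (suc n)) ⟩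
    ℚᵘ.mkℚᵘ (ℤ.+ 1) n ℚᵘ.* ℚᵘ.mkℚᵘ (ℤ.+ suc n) 0        ≈⟨ ℚᵘ.*≡* (cong (λ m → ℤ.+ suc m) integral) ⟩
    toℚᵘ 1ℚ                                             ∎)
  where
  open import Relation.Binary.Reasoning.Setoid ℚᵘP.≃-setoid
  integral : (n ℕ.+ 0 ℕ.* suc n) ℕ.* 1 ≡ n ℕ.* 1 ℕ.+ 0 ℕ.* suc (n ℕ.* 1)
  integral = trans (ℕP.*-identityʳ _) (trans (ℕP.+-identityʳ n) (sym (trans (ℕP.+-identityʳ _) (ℕP.*-identityʳ n))))

-- recipℕ is multiplicative (the junk value recipℕ 0 = 0 is compatible with this)
recipℕ-* : ∀ a b → recipℕ (a ℕ.* b) ≡ recipℕ a * recipℕ b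
recipℕ-* zero b = sym (ℚP.*-zeroˡ (recipℕ b))
recipℕ-* (suc a) zero = trans (cong recipℕ (ℕP.*-zeroʳ (suc a))) (sym (ℚP.*-zeroʳ (recipℕ (suc a))))
recipℕ-* (suc a) (suc b) = begin
    r                                                    ≡⟨ ℚP.*-identityʳ r ⟨
    r * 1ℚ                                               ≡⟨ cong (r *_) (sym (cong₂ _*_ (recipℕ-inverse a) (recipℕ-inverse b))) ⟩
    r * ((ra * na) * (rb * nb))                          ≡⟨ ℚS.solve 5 (λ r ra rb na nb → r :* ((ra :* na) :* (rb :* nb)) := (r :* (na :* nb)) :* (ra :* rb)) refl r ra rb na nb ⟩
    (r * (na * nb)) * (ra * rb)                          ≡⟨ cong (λ z → (r * z) * (ra * rb)) (sym (ℕ→ℚ-* (suc a) (suc b))) ⟩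
    (r * ℕ→ℚ (suc a ℕ.* suc b)) * (ra * rb)              ≡⟨ cong (_* (ra * rb)) (recipℕ-inverse (b ℕ.+ a ℕ.* suc b)) ⟩
    1ℚ * (ra * rb)                                       ≡⟨ ℚP.*-identityˡ (ra * rb) ⟩
    ra * rb                                              ∎
  where
  open ≡-Reasoning
  open ℚS
  r = recipℕ (suc a ℕ.* suc b)
  ra = recipℕ (suc a)
  rb = recipℕ (suc b)
  na = ℕ→ℚ (suc a)
  nb = ℕ→ℚ (suc b)

recipℕ-cancel : ∀ a b → ℕ→ℚ (suc a) * recipℕ (suc a ℕ.* b) ≡ recipℕ b
recipℕ-cancel a b = begin
  ℕ→ℚ (suc a) * recipℕ (suc a ℕ.* b)               ≡⟨ cong (ℕ→ℚ (suc a) *_) (recipℕ-* (suc a) b) ⟩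
  ℕ→ℚ (suc a) * (recipℕ (suc a) * recipℕ b)        ≡⟨ ℚS.solve 3 (λ n r s → n :* (r :* s) := (r :* n) :* s) refl (ℕ→ℚ (suc a)) (recipℕ (suc a)) (recipℕ b) ⟩
  (recipℕ (suc a) * ℕ→ℚ (suc a)) * recipℕ b        ≡⟨ cong (_* recipℕ b) (recipℕ-inverse a) ⟩
  1ℚ * recipℕ b                                    ≡⟨ ℚP.*-identityˡ (recipℕ b) ⟩
  recipℕ b                                         ∎
  where open ≡-Reasoning
        open ℚS

-- The Cauchy product is
-- handled through its recursion on the first factor (*ₛ-suc), from which each
-- ring law follows by induction on the coefficient index.

map-applyUpTo : ∀ {A B : Set} (g : A → B) (h : ℕ → A) m → map g (applyUpTo h m) ≡ applyUpTo (g ∘ h) m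
map-applyUpTo g h zero = refl
map-applyUpTo g h (suc m) = cong (g (h 0) ∷_) (map-applyUpTo g (h ∘ suc) m)

tailₛ : Series → Series
tailₛ s i = s (suc i)

*ₛ-suc : ∀ s t n → (s *ₛ t) (suc n) ≡ s 0 * t (suc n) + (tailₛ s *ₛ t) n
*ₛ-suc s t n = cong (λ l → s 0 * t (suc n) + sumℚ l)
  (trans (map-applyUpTo (λ i → s i * t (suc n ℕ.∸ i)) suc (suc n))
         (sym (map-applyUpTo (λ i → s (suc i) * t (n ℕ.∸ i)) (λ i → i) (suc n))))

-ₛ_ : Series → Series
(-ₛ s) n = - s n

≈ₛ-refl : ∀ {s} → s ≈ₛ s
≈ₛ-refl n = refl

≈ₛ-sym : ∀ {s t} → s ≈ₛ t → t ≈ₛ s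
≈ₛ-sym e n = sym (e n)

≈ₛ-trans : ∀ {s t u} → s ≈ₛ t → t ≈ₛ u → s ≈ₛ u
≈ₛ-trans e e' n = trans (e n) (e' n)

≡⇒≈ₛ : ∀ {s t} → s ≡ t → s ≈ₛ t
≡⇒≈ₛ refl = ≈ₛ-refl

+ₛ-cong : ∀ {s s' t t'} → s ≈ₛ s' → t ≈ₛ t' → s +ₛ t ≈ₛ s' +ₛ t'
+ₛ-cong e e' n = cong₂ _+_ (e n) (e' n)

*ₛ-cong : ∀ {s s' t t'} → s ≈ₛ s' → t ≈ₛ t' → s *ₛ t ≈ₛ s' *ₛ t'
*ₛ-cong {s} {s'} {t} {t'} e e' zero = cong₂ (λ a b → a * b + 0ℚ) (e 0) (e' 0)
*ₛ-cong {s} {s'} {t} {t'} e e' (suc n) = begin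
  (s *ₛ t) (suc n)                          ≡⟨ *ₛ-suc s t n ⟩
  s 0 * t (suc n) + (tailₛ s *ₛ t) n        ≡⟨ cong₂ _+_ (cong₂ _*_ (e 0) (e' (suc n))) (*ₛ-cong (λ i → e (suc i)) e' n) ⟩
  s' 0 * t' (suc n) + (tailₛ s' *ₛ t') n    ≡⟨ *ₛ-suc s' t' n ⟨
  (s' *ₛ t') (suc n)                        ∎
  where open ≡-Reasoning

+ₛ-congˡ : ∀ s {t t'} → t ≈ₛ t' → s +ₛ t ≈ₛ s +ₛ t'
+ₛ-congˡ s = +ₛ-cong {s} {s} ≈ₛ-refl

+ₛ-congʳ : ∀ t {s s'} → s ≈ₛ s' → s +ₛ t ≈ₛ s' +ₛ t
+ₛ-congʳ t e = +ₛ-cong {t = t} {t} e ≈ₛ-refl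

*ₛ-congˡ : ∀ s {t t'} → t ≈ₛ t' → s *ₛ t ≈ₛ s *ₛ t'
*ₛ-congˡ s = *ₛ-cong {s} {s} ≈ₛ-refl

*ₛ-congʳ : ∀ t {s s'} → s ≈ₛ s' → s *ₛ t ≈ₛ s' *ₛ t
*ₛ-congʳ t e = *ₛ-cong {t = t} {t} e ≈ₛ-refl

-ₛ-cong : ∀ {s t} → s ≈ₛ t → -ₛ s ≈ₛ -ₛ t
-ₛ-cong e n = cong -_ (e n)

*ₛ-zeroˡ : ∀ t → zeroₛ *ₛ t ≈ₛ zeroₛ
*ₛ-zeroˡ t zero = ℚS.solve 1 (λ x → con 0ℚ :* x :+ con 0ℚ := con 0ℚ) refl (t 0)
  where open ℚS
*ₛ-zeroˡ t (suc n) = begin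
  (zeroₛ *ₛ t) (suc n)                      ≡⟨ *ₛ-suc zeroₛ t n ⟩
  0ℚ * t (suc n) + (zeroₛ *ₛ t) n           ≡⟨ cong (0ℚ * t (suc n) +_) (*ₛ-zeroˡ t n) ⟩
  0ℚ * t (suc n) + 0ℚ                       ≡⟨ ℚS.solve 1 (λ x → con 0ℚ :* x :+ con 0ℚ := con 0ℚ) refl (t (suc n)) ⟩
  0ℚ                                        ∎
  where open ≡-Reasoning
        open ℚS

*ₛ-identityˡ : ∀ t → oneₛ *ₛ t ≈ₛ t
*ₛ-identityˡ t zero = ℚS.solve 1 (λ x → con 1ℚ :* x :+ con 0ℚ := x) refl (t 0)
  where open ℚS
*ₛ-identityˡ t (suc n) = begin
  (oneₛ *ₛ t) (suc n)                       ≡⟨ *ₛ-suc oneₛ t n ⟩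
  1ℚ * t (suc n) + (zeroₛ *ₛ t) n           ≡⟨ cong (1ℚ * t (suc n) +_) (*ₛ-zeroˡ t n) ⟩
  1ℚ * t (suc n) + 0ℚ                       ≡⟨ ℚS.solve 1 (λ x → con 1ℚ :* x :+ con 0ℚ := x) refl (t (suc n)) ⟩
  t (suc n)                                 ∎
  where open ≡-Reasoning
        open ℚS

*ₛ-identityʳ : ∀ t → t *ₛ oneₛ ≈ₛ t
*ₛ-identityʳ t zero = ℚS.solve 1 (λ x → x :* con 1ℚ :+ con 0ℚ := x) refl (t 0)
  where open ℚS
*ₛ-identityʳ t (suc n) = begin
  (t *ₛ oneₛ) (suc n)                       ≡⟨ *ₛ-suc t oneₛ n ⟩
  t 0 * 0ℚ + (tailₛ t *ₛ oneₛ) n            ≡⟨ cong (t 0 * 0ℚ +_) (*ₛ-identityʳ (tailₛ t) n) ⟩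
  t 0 * 0ℚ + t (suc n)                      ≡⟨ ℚS.solve 2 (λ x y → x :* con 0ℚ :+ y := y) refl (t 0) (t (suc n)) ⟩
  t (suc n)                                 ∎
  where open ≡-Reasoning
        open ℚS

*ₛ-distribʳ : ∀ t s s' → (s +ₛ s') *ₛ t ≈ₛ s *ₛ t +ₛ s' *ₛ t
*ₛ-distribʳ t s s' zero = ℚS.solve 3 (λ a b c → (a :+ b) :* c :+ con 0ℚ := (a :* c :+ con 0ℚ) :+ (b :* c :+ con 0ℚ)) refl (s 0) (s' 0) (t 0)
  where open ℚS
*ₛ-distribʳ t s s' (suc n) = begin
  ((s +ₛ s') *ₛ t) (suc n)
    ≡⟨ *ₛ-suc (s +ₛ s') t n ⟩
  (s 0 + s' 0) * t (suc n) + ((tailₛ s +ₛ tailₛ s') *ₛ t) n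
    ≡⟨ cong ((s 0 + s' 0) * t (suc n) +_) (*ₛ-distribʳ t (tailₛ s) (tailₛ s') n) ⟩
  (s 0 + s' 0) * t (suc n) + ((tailₛ s *ₛ t) n + (tailₛ s' *ₛ t) n)
    ≡⟨ ℚS.solve 5 (λ a b c x y → (a :+ b) :* c :+ (x :+ y) := (a :* c :+ x) :+ (b :* c :+ y)) refl (s 0) (s' 0) (t (suc n)) ((tailₛ s *ₛ t) n) ((tailₛ s' *ₛ t) n) ⟩
  (s 0 * t (suc n) + (tailₛ s *ₛ t) n) + (s' 0 * t (suc n) + (tailₛ s' *ₛ t) n)
    ≡⟨ cong₂ _+_ (*ₛ-suc s t n) (*ₛ-suc s' t n) ⟨
  (s *ₛ t +ₛ s' *ₛ t) (suc n) ∎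
  where open ≡-Reasoning
        open ℚS

*ₛ-distribˡ : ∀ t s s' → t *ₛ (s +ₛ s') ≈ₛ t *ₛ s +ₛ t *ₛ s'
*ₛ-distribˡ t s s' zero = ℚS.solve 3 (λ a b c → c :* (a :+ b) :+ con 0ℚ := (c :* a :+ con 0ℚ) :+ (c :* b :+ con 0ℚ)) refl (s 0) (s' 0) (t 0)
  where open ℚS
*ₛ-distribˡ t s s' (suc n) = begin
  (t *ₛ (s +ₛ s')) (suc n)
    ≡⟨ *ₛ-suc t (s +ₛ s') n ⟩
  t 0 * (s (suc n) + s' (suc n)) + (tailₛ t *ₛ (s +ₛ s')) n
    ≡⟨ cong (t 0 * (s (suc n) + s' (suc n)) +_) (*ₛ-distribˡ (tailₛ t) s s' n) ⟩
  t 0 * (s (suc n) + s' (suc n)) + ((tailₛ t *ₛ s) n + (tailₛ t *ₛ s') n)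
    ≡⟨ ℚS.solve 5 (λ a b c x y → c :* (a :+ b) :+ (x :+ y) := (c :* a :+ x) :+ (c :* b :+ y)) refl (s (suc n)) (s' (suc n)) (t 0) ((tailₛ t *ₛ s) n) ((tailₛ t *ₛ s') n) ⟩
  (t 0 * s (suc n) + (tailₛ t *ₛ s) n) + (t 0 * s' (suc n) + (tailₛ t *ₛ s') n)
    ≡⟨ cong₂ _+_ (*ₛ-suc t s n) (*ₛ-suc t s' n) ⟨
  (t *ₛ s +ₛ t *ₛ s') (suc n) ∎
  where open ≡-Reasoning
        open ℚS

*ₛ-scalarˡ : ∀ c s t → (c ·ₛ s) *ₛ t ≈ₛ c ·ₛ (s *ₛ t)
*ₛ-scalarˡ c s t zero = ℚS.solve 3 (λ a b d → (d :* a) :* b :+ con 0ℚ := d :* (a :* b :+ con 0ℚ)) refl (s 0) (t 0) c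
  where open ℚS
*ₛ-scalarˡ c s t (suc n) = begin
  ((c ·ₛ s) *ₛ t) (suc n)                         ≡⟨ *ₛ-suc (c ·ₛ s) t n ⟩
  c * s 0 * t (suc n) + ((c ·ₛ tailₛ s) *ₛ t) n   ≡⟨ cong (c * s 0 * t (suc n) +_) (*ₛ-scalarˡ c (tailₛ s) t n) ⟩
  c * s 0 * t (suc n) + c * (tailₛ s *ₛ t) n      ≡⟨ ℚS.solve 4 (λ a b d x → (d :* a) :* b :+ d :* x := d :* (a :* b :+ x)) refl (s 0) (t (suc n)) c ((tailₛ s *ₛ t) n) ⟩
  c * (s 0 * t (suc n) + (tailₛ s *ₛ t) n)        ≡⟨ cong (c *_) (*ₛ-suc s t n) ⟨
  c * (s *ₛ t) (suc n)                            ∎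
  where open ≡-Reasoning
        open ℚS

*ₛ-comm : ∀ s t → s *ₛ t ≈ₛ t *ₛ s
*ₛ-comm s t zero = ℚS.solve 2 (λ a b → a :* b :+ con 0ℚ := b :* a :+ con 0ℚ) refl (s 0) (t 0)
  where open ℚS
*ₛ-comm s t (suc zero) = begin
  (s *ₛ t) 1                       ≡⟨ *ₛ-suc s t 0 ⟩
  s 0 * t 1 + (tailₛ s *ₛ t) 0     ≡⟨ cong (s 0 * t 1 +_) (*ₛ-comm (tailₛ s) t 0) ⟩
  s 0 * t 1 + (t 0 * s 1 + 0ℚ)     ≡⟨ ℚS.solve 4 (λ a b c d → a :* b :+ (c :* d :+ con 0ℚ) := c :* d :+ (a :* b :+ con 0ℚ)) refl (s 0) (t 1) (t 0) (s 1) ⟩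
  t 0 * s 1 + (s 0 * t 1 + 0ℚ)     ≡⟨ cong (t 0 * s 1 +_) (*ₛ-comm s (tailₛ t) 0) ⟩
  t 0 * s 1 + (tailₛ t *ₛ s) 0     ≡⟨ *ₛ-suc t s 0 ⟨
  (t *ₛ s) 1                       ∎
  where open ≡-Reasoning
        open ℚS
*ₛ-comm s t (suc (suc m)) = begin
  (s *ₛ t) (2 ℕ.+ m)
    ≡⟨ *ₛ-suc s t (suc m) ⟩
  s 0 * t (2 ℕ.+ m) + (tailₛ s *ₛ t) (suc m)
    ≡⟨ cong (s 0 * t (2 ℕ.+ m) +_) (trans (*ₛ-comm (tailₛ s) t (suc m)) (*ₛ-suc t (tailₛ s) m)) ⟩
  s 0 * t (2 ℕ.+ m) + (t 0 * s (2 ℕ.+ m) + (tailₛ t *ₛ tailₛ s) m)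
    ≡⟨ cong (λ z → s 0 * t (2 ℕ.+ m) + (t 0 * s (2 ℕ.+ m) + z)) (*ₛ-comm (tailₛ t) (tailₛ s) m) ⟩
  s 0 * t (2 ℕ.+ m) + (t 0 * s (2 ℕ.+ m) + (tailₛ s *ₛ tailₛ t) m)
    ≡⟨ ℚS.solve 5 (λ a b c d x → a :* b :+ (c :* d :+ x) := c :* d :+ (a :* b :+ x)) refl (s 0) (t (2 ℕ.+ m)) (t 0) (s (2 ℕ.+ m)) ((tailₛ s *ₛ tailₛ t) m) ⟩
  t 0 * s (2 ℕ.+ m) + (s 0 * t (2 ℕ.+ m) + (tailₛ s *ₛ tailₛ t) m)
    ≡⟨ cong (t 0 * s (2 ℕ.+ m) +_) (trans (*ₛ-comm (tailₛ t) s (suc m)) (*ₛ-suc s (tailₛ t) m)) ⟨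
  t 0 * s (2 ℕ.+ m) + (tailₛ t *ₛ s) (suc m)
    ≡⟨ *ₛ-suc t s (suc m) ⟨
  (t *ₛ s) (suc (suc m)) ∎
  where open ≡-Reasoning
        open ℚS

*ₛ-assoc : ∀ s t u → (s *ₛ t) *ₛ u ≈ₛ s *ₛ (t *ₛ u)
*ₛ-assoc s t u zero = ℚS.solve 3 (λ a b c → (a :* b :+ con 0ℚ) :* c :+ con 0ℚ := a :* (b :* c :+ con 0ℚ) :+ con 0ℚ) refl (s 0) (t 0) (u 0)
  where open ℚS
*ₛ-assoc s t u (suc n) = begin
  ((s *ₛ t) *ₛ u) (suc n)
    ≡⟨ *ₛ-suc (s *ₛ t) u n ⟩
  (s 0 * t 0 + 0ℚ) * u (suc n) + (tailₛ (s *ₛ t) *ₛ u) n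
    ≡⟨ cong ((s 0 * t 0 + 0ℚ) * u (suc n) +_) tail-product ⟩
  (s 0 * t 0 + 0ℚ) * u (suc n) + (s 0 * (tailₛ t *ₛ u) n + (tailₛ s *ₛ (t *ₛ u)) n)
    ≡⟨ ℚS.solve 5 (λ a b c x y → (a :* b :+ con 0ℚ) :* c :+ (a :* x :+ y) := a :* (b :* c :+ x) :+ y) refl (s 0) (t 0) (u (suc n)) ((tailₛ t *ₛ u) n) ((tailₛ s *ₛ (t *ₛ u)) n) ⟩
  s 0 * (t 0 * u (suc n) + (tailₛ t *ₛ u) n) + (tailₛ s *ₛ (t *ₛ u)) n
    ≡⟨ cong (λ z → s 0 * z + (tailₛ s *ₛ (t *ₛ u)) n) (*ₛ-suc t u n) ⟨
  s 0 * (t *ₛ u) (suc n) + (tailₛ s *ₛ (t *ₛ u)) n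
    ≡⟨ *ₛ-suc s (t *ₛ u) n ⟨
  (s *ₛ (t *ₛ u)) (suc n) ∎
  where
  open ≡-Reasoning
  open ℚS
  -- tail (s t) = s₀ (tail t) + (tail s) t, then distribute and use induction
  tail-product : (tailₛ (s *ₛ t) *ₛ u) n ≡ s 0 * (tailₛ t *ₛ u) n + (tailₛ s *ₛ (t *ₛ u)) n
  tail-product = trans (*ₛ-congʳ u (*ₛ-suc s t) n)
    (trans (*ₛ-distribʳ u (s 0 ·ₛ tailₛ t) (tailₛ s *ₛ t) n)
      (cong₂ _+_ (*ₛ-scalarˡ (s 0) (tailₛ t) u n) (*ₛ-assoc (tailₛ s) t u n)))

seriesRing : CommutativeRing 0ℓ 0ℓ
seriesRing = record
  { Carrier = Series ; _≈_ = _≈ₛ_ ; _+_ = _+ₛ_ ; _*_ = _*ₛ_ ; -_ = -ₛ_ ; 0# = zeroₛ ; 1# = oneₛ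
  ; isCommutativeRing = record
    { isRing = record
      { +-isAbelianGroup = record
        { isGroup = record
          { isMonoid = record
            { isSemigroup = record
              { isMagma = record
                { isEquivalence = record { refl = λ {s} → ≈ₛ-refl {s} ; sym = ≈ₛ-sym ; trans = ≈ₛ-trans }
                ; ∙-cong = +ₛ-cong }
              ; assoc = λ s t u n → ℚP.+-assoc (s n) (t n) (u n) }
            ; identity = (λ s n → ℚP.+-identityˡ (s n)) , (λ s n → ℚP.+-identityʳ (s n)) }
          ; inverse = (λ s n → ℚP.+-inverseˡ (s n)) , (λ s n → ℚP.+-inverseʳ (s n))
          ; ⁻¹-cong = -ₛ-cong }
        ; comm = λ s t n → ℚP.+-comm (s n) (t n) }
      ; *-cong = *ₛ-cong
      ; *-assoc = *ₛ-assoc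
      ; *-identity = *ₛ-identityˡ , *ₛ-identityʳ
      ; distrib = *ₛ-distribˡ , *ₛ-distribʳ }
    ; *-comm = *ₛ-comm } }

-- constant series; this embedding ℚ → Series is a ring homomorphism, which
-- lets the ring solver treat rational constants as coefficients
constₛ : ℚ → Series
constₛ c zero = c
constₛ c (suc _) = 0ℚ

constₛ-+ : ∀ a b → constₛ (a + b) ≈ₛ constₛ a +ₛ constₛ b
constₛ-+ a b zero = refl
constₛ-+ a b (suc n) = refl

constₛ-* : ∀ a b → constₛ (a * b) ≈ₛ constₛ a *ₛ constₛ b
constₛ-* a b zero = sym (ℚP.+-identityʳ (a * b))
constₛ-* a b (suc n) = sym (begin
  (constₛ a *ₛ constₛ b) (suc n)    ≡⟨ *ₛ-suc (constₛ a) (constₛ b) n ⟩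
  a * 0ℚ + (zeroₛ *ₛ constₛ b) n    ≡⟨ cong (a * 0ℚ +_) (*ₛ-zeroˡ (constₛ b) n) ⟩
  a * 0ℚ + 0ℚ                       ≡⟨ ℚS.solve 1 (λ x → x :* con 0ℚ :+ con 0ℚ := con 0ℚ) refl a ⟩
  0ℚ                                ∎)
  where open ≡-Reasoning
        open ℚS

constₛ-neg : ∀ a → constₛ (- a) ≈ₛ -ₛ constₛ a
constₛ-neg a zero = refl
constₛ-neg a (suc n) = refl

constₛ-*ₛ : ∀ c s → constₛ c *ₛ s ≈ₛ c ·ₛ s
constₛ-*ₛ c s zero = ℚP.+-identityʳ (c * s 0)
constₛ-*ₛ c s (suc n) = trans (*ₛ-suc (constₛ c) s n) (trans (cong (c * s (suc n) +_) (*ₛ-zeroˡ s n)) (ℚP.+-identityʳ _))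

constₛ-0 : constₛ 0ℚ ≈ₛ zeroₛ
constₛ-0 zero = refl
constₛ-0 (suc n) = refl

constₛ-1 : constₛ 1ℚ ≈ₛ oneₛ
constₛ-1 zero = refl
constₛ-1 (suc n) = refl

seriesACR : ACR.AlmostCommutativeRing 0ℓ 0ℓ
seriesACR = ACR.fromCommutativeRing seriesRing

constₛ-hom : CommutativeRing.rawRing ℚP.+-*-commutativeRing ACR.-Raw-AlmostCommutative⟶ seriesACR
constₛ-hom = record
  { ⟦_⟧ = constₛ ; +-homo = constₛ-+ ; *-homo = constₛ-* ; -‿homo = constₛ-neg
  ; 0-homo = constₛ-0 ; 1-homo = constₛ-1 }

-- the solver only uses this to recognise syntactically equal constants
constₛ-≟ : ∀ a b → Maybe (constₛ a ≈ₛ constₛ b)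
constₛ-≟ a b with a ℚP.≟ b
... | yes refl = just ≈ₛ-refl
... | no _ = nothing

module SeriesSolver = RingSolver (CommutativeRing.rawRing ℚP.+-*-commutativeRing) seriesACR constₛ-hom constₛ-≟

module SeriesReasoning where
  open Relation.Binary.Reasoning.Setoid (CommutativeRing.setoid seriesRing) public
  open SeriesSolver public using (solve; _:+_; _:*_; _:-_; :-_; con; _:=_)

-- The formal derivative is a derivation.  It is compared with the Euler
-- operator θ = x d/dx, whose Leibniz rule follows coefficientwise by
-- induction; the factor x is then cancelled.

Xₛ : Series
Xₛ zero = 0ℚ
Xₛ (suc zero) = 1ℚ
Xₛ (suc (suc _)) = 0ℚ

Xₛ-*ₛ-zero : ∀ s → (Xₛ *ₛ s) 0 ≡ 0ℚ
Xₛ-*ₛ-zero s = ℚS.solve 1 (λ x → con 0ℚ :* x :+ con 0ℚ := con 0ℚ) refl (s 0)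
  where open ℚS

Xₛ-*ₛ-suc : ∀ s n → (Xₛ *ₛ s) (suc n) ≡ s n
Xₛ-*ₛ-suc s n = begin
  (Xₛ *ₛ s) (suc n)                  ≡⟨ *ₛ-suc Xₛ s n ⟩
  0ℚ * s (suc n) + (tailₛ Xₛ *ₛ s) n ≡⟨ cong (0ℚ * s (suc n) +_) (trans (*ₛ-congʳ s tail-Xₛ n) (*ₛ-identityˡ s n)) ⟩
  0ℚ * s (suc n) + s n               ≡⟨ ℚS.solve 2 (λ x y → con 0ℚ :* x :+ y := y) refl (s (suc n)) (s n) ⟩
  s n                                ∎
  where
  open ≡-Reasoning
  open ℚS
  tail-Xₛ : tailₛ Xₛ ≈ₛ oneₛ
  tail-Xₛ zero = refl
  tail-Xₛ (suc n) = refl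

Xₛ-cancel : ∀ {a b} → Xₛ *ₛ a ≈ₛ Xₛ *ₛ b → a ≈ₛ b
Xₛ-cancel {a} {b} e n = trans (sym (Xₛ-*ₛ-suc a n)) (trans (e (suc n)) (Xₛ-*ₛ-suc b n))

θ : Series → Series
θ s n = ℕ→ℚ n * s n

θ-tail : ∀ s → tailₛ (θ s) ≈ₛ tailₛ s +ₛ θ (tailₛ s)
θ-tail s n = begin
  ℕ→ℚ (suc n) * s (suc n)              ≡⟨ cong (_* s (suc n)) (ℕ→ℚ-suc n) ⟩
  (1ℚ + ℕ→ℚ n) * s (suc n)             ≡⟨ ℚS.solve 2 (λ m x → (con 1ℚ :+ m) :* x := x :+ m :* x) refl (ℕ→ℚ n) (s (suc n)) ⟩
  s (suc n) + ℕ→ℚ n * s (suc n)        ∎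
  where open ≡-Reasoning
        open ℚS

θ-leibniz : ∀ s t → θ (s *ₛ t) ≈ₛ θ s *ₛ t +ₛ s *ₛ θ t
θ-leibniz s t zero = ℚS.solve 2 (λ x y → con 0ℚ :* (x :* y :+ con 0ℚ) := (con 0ℚ :* x :* y :+ con 0ℚ) :+ (x :* (con 0ℚ :* y) :+ con 0ℚ)) refl (s 0) (t 0)
  where open ℚS
θ-leibniz s t (suc n) = begin
  ℕ→ℚ (suc n) * (s *ₛ t) (suc n)
    ≡⟨ cong₂ _*_ (ℕ→ℚ-suc n) (*ₛ-suc s t n) ⟩
  (1ℚ + N) * (s₀ * T + A)
    ≡⟨ ℚS.solve 4 (λ N s₀ T A → (con 1ℚ :+ N) :* (s₀ :* T :+ A) := s₀ :* ((con 1ℚ :+ N) :* T) :+ (A :+ N :* A)) refl N s₀ T A ⟩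
  s₀ * ((1ℚ + N) * T) + (A + N * A)
    ≡⟨ cong (λ z → s₀ * ((1ℚ + N) * T) + (A + z)) (θ-leibniz (tailₛ s) t n) ⟩
  s₀ * ((1ℚ + N) * T) + (A + (Bₜ + Cₜ))
    ≡⟨ ℚS.solve 6 (λ N s₀ T A B C → s₀ :* ((con 1ℚ :+ N) :* T) :+ (A :+ (B :+ C)) := (con 0ℚ :* s₀ :* T :+ (A :+ B)) :+ (s₀ :* ((con 1ℚ :+ N) :* T) :+ C)) refl N s₀ T A Bₜ Cₜ ⟩
  (θ s 0 * T + (A + Bₜ)) + (s₀ * ((1ℚ + N) * T) + Cₜ)
    ≡⟨ cong₂ (λ u v → (θ s 0 * T + u) + (s₀ * (v * T) + Cₜ)) θ-tail-product (ℕ→ℚ-suc n) ⟨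
  (θ s 0 * T + (tailₛ (θ s) *ₛ t) n) + (s₀ * θ t (suc n) + Cₜ)
    ≡⟨ cong₂ _+_ (*ₛ-suc (θ s) t n) (*ₛ-suc s (θ t) n) ⟨
  (θ s *ₛ t +ₛ s *ₛ θ t) (suc n) ∎
  where
  open ≡-Reasoning
  open ℚS
  N = ℕ→ℚ n
  s₀ = s 0
  T = t (suc n)
  A = (tailₛ s *ₛ t) n
  Bₜ = (θ (tailₛ s) *ₛ t) n
  Cₜ = (tailₛ s *ₛ θ t) n
  θ-tail-product : (tailₛ (θ s) *ₛ t) n ≡ A + Bₜ
  θ-tail-product = trans (*ₛ-congʳ t (θ-tail s) n) (*ₛ-distribʳ t (tailₛ s) (θ (tailₛ s)) n)

θ≈Xₛ*deriv : ∀ s → θ s ≈ₛ Xₛ *ₛ deriv s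
θ≈Xₛ*deriv s zero = trans (ℚP.*-zeroˡ (s 0)) (sym (Xₛ-*ₛ-zero (deriv s)))
θ≈Xₛ*deriv s (suc n) = sym (Xₛ-*ₛ-suc (deriv s) n)

deriv-leibniz : ∀ s t → deriv (s *ₛ t) ≈ₛ deriv s *ₛ t +ₛ s *ₛ deriv t
deriv-leibniz s t = Xₛ-cancel (begin
  Xₛ *ₛ deriv (s *ₛ t)                          ≈⟨ θ≈Xₛ*deriv (s *ₛ t) ⟨
  θ (s *ₛ t)                                    ≈⟨ θ-leibniz s t ⟩
  θ s *ₛ t +ₛ s *ₛ θ t                          ≈⟨ +ₛ-cong (*ₛ-congʳ t (θ≈Xₛ*deriv s)) (*ₛ-congˡ s (θ≈Xₛ*deriv t)) ⟩
  Xₛ *ₛ deriv s *ₛ t +ₛ s *ₛ (Xₛ *ₛ deriv t)    ≈⟨ solve 5 (λ x a b c d → x :* a :* b :+ c :* (x :* d) := x :* (a :* b :+ c :* d)) ≈ₛ-refl Xₛ (deriv s) t s (deriv t) ⟩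
  Xₛ *ₛ (deriv s *ₛ t +ₛ s *ₛ deriv t)          ∎)
  where
  open SeriesReasoning

deriv-cong : ∀ {s t} → s ≈ₛ t → deriv s ≈ₛ deriv t
deriv-cong e n = cong (ℕ→ℚ (suc n) *_) (e (suc n))

deriv-+ : ∀ s t → deriv (s +ₛ t) ≈ₛ deriv s +ₛ deriv t
deriv-+ s t n = ℚP.*-distribˡ-+ (ℕ→ℚ (suc n)) (s (suc n)) (t (suc n))

deriv-neg : ∀ s → deriv (-ₛ s) ≈ₛ -ₛ deriv s
deriv-neg s n = ℚS.solve 2 (λ a b → a :* (:- b) := :- (a :* b)) refl (ℕ→ℚ (suc n)) (s (suc n))
  where open ℚS

deriv-const : ∀ c → deriv (constₛ c) ≈ₛ constₛ 0ℚ
deriv-const c zero = ℚP.*-zeroʳ 1ℚ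
deriv-const c (suc n) = ℚP.*-zeroʳ (ℕ→ℚ (suc (suc n)))

deriv-Xₛ : deriv Xₛ ≈ₛ constₛ 1ℚ
deriv-Xₛ zero = refl
deriv-Xₛ (suc n) = ℚP.*-zeroʳ (ℕ→ℚ (suc (suc n)))

-- The generating function f satisfies D f = x with D = 1 - 6x + x², and D is
-- cancellable.  Differentiating gives D² f' = 1 - x², and comparing D² f² with
-- D² (x²/(1-x²)) f' shows f² = U f' where U = x²/(1-x²).  Hence every power
-- of f arises from f by repeatedly applying the operator U d/dx.

Dₛ : Series
Dₛ = constₛ 1ℚ +ₛ -ₛ (constₛ (ℕ→ℚ 6) *ₛ Xₛ) +ₛ Xₛ *ₛ Xₛ

D'ₛ : Series
D'ₛ = -ₛ constₛ (ℕ→ℚ 6) +ₛ (Xₛ +ₛ Xₛ)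

Qₛ : Series
Qₛ = constₛ 1ℚ +ₛ -ₛ (Xₛ *ₛ Xₛ)

P : Series
P = invOneMinusX²

U : Series
U = Xₛ *ₛ Xₛ *ₛ P

Dₛ-coefficient : ∀ s n → (Dₛ *ₛ s) n ≡ s n + - (ℕ→ℚ 6 * (Xₛ *ₛ s) n) + (Xₛ *ₛ (Xₛ *ₛ s)) n
Dₛ-coefficient s n = trans
  (solve 3 (λ a b c → (con 1ℚ :- a :* b :+ b :* b) :* c := c :- a :* (b :* c) :+ b :* (b :* c)) ≈ₛ-refl (constₛ (ℕ→ℚ 6)) Xₛ s n)
  (cong (λ z → s n + - z + (Xₛ *ₛ (Xₛ *ₛ s)) n) (constₛ-*ₛ (ℕ→ℚ 6) (Xₛ *ₛ s) n))
  where open SeriesReasoning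

Dₛ-coefficient-0 : ∀ s → (Dₛ *ₛ s) 0 ≡ s 0 + - (ℕ→ℚ 6 * 0ℚ) + 0ℚ
Dₛ-coefficient-0 s = trans (Dₛ-coefficient s 0)
  (cong₂ (λ u v → s 0 + - (ℕ→ℚ 6 * u) + v) (Xₛ-*ₛ-zero s) (Xₛ-*ₛ-zero (Xₛ *ₛ s)))

Dₛ-coefficient-1 : ∀ s → (Dₛ *ₛ s) 1 ≡ s 1 + - (ℕ→ℚ 6 * s 0) + 0ℚ
Dₛ-coefficient-1 s = trans (Dₛ-coefficient s 1)
  (cong₂ (λ u v → s 1 + - (ℕ→ℚ 6 * u) + v) (Xₛ-*ₛ-suc s 0) (trans (Xₛ-*ₛ-suc (Xₛ *ₛ s) 0) (Xₛ-*ₛ-zero s)))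

Dₛ-coefficient-2+ : ∀ s n → (Dₛ *ₛ s) (suc (suc n)) ≡ s (suc (suc n)) + - (ℕ→ℚ 6 * s (suc n)) + s n
Dₛ-coefficient-2+ s n = trans (Dₛ-coefficient s (suc (suc n)))
  (cong₂ (λ u v → s (suc (suc n)) + - (ℕ→ℚ 6 * u) + v) (Xₛ-*ₛ-suc s (suc n)) (trans (Xₛ-*ₛ-suc (Xₛ *ₛ s) (suc n)) (Xₛ-*ₛ-suc s n)))

-- the defining recurrence of the balancing numbers, as a series identity
Dₛ*f≈X : Dₛ *ₛ f ≈ₛ Xₛ
Dₛ*f≈X zero = Dₛ-coefficient-0 f
Dₛ*f≈X (suc zero) = Dₛ-coefficient-1 f
Dₛ*f≈X (suc (suc n)) = trans (Dₛ-coefficient-2+ f n)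
  (ℚS.solve 3 (λ a b c → (a :* b :- c) :+ :- (a :* b) :+ c := con 0ℚ) refl (ℕ→ℚ 6) (B (suc n)) (B n))
  where open ℚS

-- D has constant term 1, so it is not a zero divisor: the coefficients of s
-- vanish successively
Dₛ-cancel : ∀ s → Dₛ *ₛ s ≈ₛ zeroₛ → s ≈ₛ zeroₛ
Dₛ-cancel s e n = proj₁ (vanish n)
  where
  open ℚS using (_:+_; _:*_; _:-_; :-_; con; _:=_)
  s₀ : s 0 ≡ 0ℚ
  s₀ = trans (ℚS.solve 2 (λ a k → a := a :+ :- (k :* con 0ℚ) :+ con 0ℚ) refl (s 0) (ℕ→ℚ 6))
             (trans (sym (Dₛ-coefficient-0 s)) (e 0))
  s₁ : s 1 ≡ 0ℚ
  s₁ = trans (ℚS.solve 2 (λ a k → a := a :+ :- (k :* con 0ℚ) :+ con 0ℚ) refl (s 1) (ℕ→ℚ 6))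
             (trans (cong (λ z → s 1 + - (ℕ→ℚ 6 * z) + 0ℚ) (sym s₀)) (trans (sym (Dₛ-coefficient-1 s)) (e 1)))
  vanish : ∀ n → s n ≡ 0ℚ × s (suc n) ≡ 0ℚ
  vanish zero = s₀ , s₁
  vanish (suc n) with vanish n
  ... | (sₙ , sₙ₊₁) = sₙ₊₁ , (begin
      s (suc (suc n))
        ≡⟨ ℚS.solve 4 (λ x y z k → x := (x :+ :- (k :* y) :+ z) :- (:- (k :* y) :+ z)) refl (s (suc (suc n))) (s (suc n)) (s n) (ℕ→ℚ 6) ⟩
      (s (suc (suc n)) + - (ℕ→ℚ 6 * s (suc n)) + s n) - (- (ℕ→ℚ 6 * s (suc n)) + s n)
        ≡⟨ cong₂ (λ u v → u - v) (trans (sym (Dₛ-coefficient-2+ s n)) (e (suc (suc n)))) (cong₂ (λ v w → - (ℕ→ℚ 6 * v) + w) sₙ₊₁ sₙ) ⟩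
      0ℚ - (- (ℕ→ℚ 6 * 0ℚ) + 0ℚ)
        ≡⟨ ℚS.solve 1 (λ k → con 0ℚ :- (:- (k :* con 0ℚ) :+ con 0ℚ) := con 0ℚ) refl (ℕ→ℚ 6) ⟩
      0ℚ ∎)
    where open ≡-Reasoning

deriv-Dₛ : deriv Dₛ ≈ₛ D'ₛ
deriv-Dₛ = begin
  deriv Dₛ
    ≈⟨ ≈ₛ-trans (deriv-+ (constₛ 1ℚ +ₛ -ₛ (constₛ (ℕ→ℚ 6) *ₛ Xₛ)) (Xₛ *ₛ Xₛ)) (+ₛ-cong (≈ₛ-trans (deriv-+ (constₛ 1ℚ) (-ₛ (constₛ (ℕ→ℚ 6) *ₛ Xₛ))) (+ₛ-congʳ (deriv (-ₛ (constₛ (ℕ→ℚ 6) *ₛ Xₛ))) (deriv-const 1ℚ))) (deriv-leibniz Xₛ Xₛ)) ⟩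
  constₛ 0ℚ +ₛ deriv (-ₛ (constₛ (ℕ→ℚ 6) *ₛ Xₛ)) +ₛ (deriv Xₛ *ₛ Xₛ +ₛ Xₛ *ₛ deriv Xₛ)
    ≈⟨ +ₛ-congʳ (deriv Xₛ *ₛ Xₛ +ₛ Xₛ *ₛ deriv Xₛ) (+ₛ-congˡ (constₛ 0ℚ) (≈ₛ-trans (deriv-neg (constₛ (ℕ→ℚ 6) *ₛ Xₛ)) (-ₛ-cong (deriv-leibniz (constₛ (ℕ→ℚ 6)) Xₛ)))) ⟩
  constₛ 0ℚ +ₛ -ₛ (deriv (constₛ (ℕ→ℚ 6)) *ₛ Xₛ +ₛ constₛ (ℕ→ℚ 6) *ₛ deriv Xₛ) +ₛ (deriv Xₛ *ₛ Xₛ +ₛ Xₛ *ₛ deriv Xₛ)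
    ≈⟨ +ₛ-cong (+ₛ-congˡ (constₛ 0ℚ) (-ₛ-cong (+ₛ-cong (*ₛ-congʳ Xₛ (deriv-const (ℕ→ℚ 6))) (*ₛ-congˡ (constₛ (ℕ→ℚ 6)) deriv-Xₛ))))
               (+ₛ-cong (*ₛ-congʳ Xₛ deriv-Xₛ) (*ₛ-congˡ Xₛ deriv-Xₛ)) ⟩
  constₛ 0ℚ +ₛ -ₛ (constₛ 0ℚ *ₛ Xₛ +ₛ constₛ (ℕ→ℚ 6) *ₛ constₛ 1ℚ) +ₛ (constₛ 1ℚ *ₛ Xₛ +ₛ Xₛ *ₛ constₛ 1ℚ)
    ≈⟨ solve 2 (λ k x → con 0ℚ :+ :- (con 0ℚ :* x :+ k :* con 1ℚ) :+ (con 1ℚ :* x :+ x :* con 1ℚ) := :- k :+ (x :+ x)) ≈ₛ-refl (constₛ (ℕ→ℚ 6)) Xₛ ⟩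
  D'ₛ ∎
  where open SeriesReasoning

deriv-Qₛ : deriv Qₛ ≈ₛ -ₛ (Xₛ +ₛ Xₛ)
deriv-Qₛ = begin
  deriv Qₛ                                       ≈⟨ deriv-+ (constₛ 1ℚ) (-ₛ (Xₛ *ₛ Xₛ)) ⟩
  deriv (constₛ 1ℚ) +ₛ deriv (-ₛ (Xₛ *ₛ Xₛ))            ≈⟨ +ₛ-cong (deriv-const 1ℚ) (≈ₛ-trans (deriv-neg (Xₛ *ₛ Xₛ)) (-ₛ-cong (deriv-leibniz Xₛ Xₛ))) ⟩
  constₛ 0ℚ +ₛ -ₛ (deriv Xₛ *ₛ Xₛ +ₛ Xₛ *ₛ deriv Xₛ)  ≈⟨ +ₛ-congˡ (constₛ 0ℚ) (-ₛ-cong (+ₛ-cong (*ₛ-congʳ Xₛ deriv-Xₛ) (*ₛ-congˡ Xₛ deriv-Xₛ))) ⟩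
  constₛ 0ℚ +ₛ -ₛ (constₛ 1ℚ *ₛ Xₛ +ₛ Xₛ *ₛ constₛ 1ℚ)  ≈⟨ solve 1 (λ x → con 0ℚ :+ :- (con 1ℚ :* x :+ x :* con 1ℚ) := :- (x :+ x)) ≈ₛ-refl Xₛ ⟩
  -ₛ (Xₛ +ₛ Xₛ)                                   ∎
  where open SeriesReasoning

D'f+Df'≈1 : D'ₛ *ₛ f +ₛ Dₛ *ₛ deriv f ≈ₛ constₛ 1ℚ
D'f+Df'≈1 = begin
  D'ₛ *ₛ f +ₛ Dₛ *ₛ deriv f           ≈⟨ +ₛ-congʳ (Dₛ *ₛ deriv f) (*ₛ-congʳ f deriv-Dₛ) ⟨
  deriv Dₛ *ₛ f +ₛ Dₛ *ₛ deriv f      ≈⟨ deriv-leibniz Dₛ f ⟨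
  deriv (Dₛ *ₛ f)                     ≈⟨ deriv-cong Dₛ*f≈X ⟩
  deriv Xₛ                            ≈⟨ deriv-Xₛ ⟩
  constₛ 1ℚ                           ∎
  where open SeriesReasoning

D²f'≈Q : Dₛ *ₛ (Dₛ *ₛ deriv f) ≈ₛ Qₛ
D²f'≈Q = begin
  Dₛ *ₛ (Dₛ *ₛ deriv f)
    ≈⟨ solve 4 (λ d d' g g' → d :* (d :* g') := d :* (d' :* g :+ d :* g') :+ :- (d' :* (d :* g))) ≈ₛ-refl Dₛ D'ₛ f (deriv f) ⟩
  Dₛ *ₛ (D'ₛ *ₛ f +ₛ Dₛ *ₛ deriv f) +ₛ -ₛ (D'ₛ *ₛ (Dₛ *ₛ f))
    ≈⟨ +ₛ-cong (*ₛ-congˡ Dₛ D'f+Df'≈1) (-ₛ-cong (*ₛ-congˡ D'ₛ Dₛ*f≈X)) ⟩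
  Dₛ *ₛ constₛ 1ℚ +ₛ -ₛ (D'ₛ *ₛ Xₛ)
    ≈⟨ solve 2 (λ k x → (con 1ℚ :- k :* x :+ x :* x) :* con 1ℚ :+ :- ((:- k :+ (x :+ x)) :* x) := con 1ℚ :- x :* x) ≈ₛ-refl (constₛ (ℕ→ℚ 6)) Xₛ ⟩
  Qₛ ∎
  where open SeriesReasoning

P*Q≈1 : P *ₛ Qₛ ≈ₛ constₛ 1ℚ
P*Q≈1 = ≈ₛ-trans (SeriesReasoning.solve 2 (λ p x → p :* (con 1ℚ :- x :* x) := p :- x :* (x :* p)) ≈ₛ-refl P Xₛ) coefficients
  where
  open SeriesReasoning using (_:*_; _:-_; con; _:=_)
  coefficients : P +ₛ -ₛ (Xₛ *ₛ (Xₛ *ₛ P)) ≈ₛ constₛ 1ℚ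
  coefficients zero = cong (λ z → 1ℚ + - z) (Xₛ-*ₛ-zero (Xₛ *ₛ P))
  coefficients (suc zero) = cong (λ z → 0ℚ + - z) (trans (Xₛ-*ₛ-suc (Xₛ *ₛ P) 0) (Xₛ-*ₛ-zero P))
  coefficients (suc (suc n)) = trans (cong (λ z → P n + - z) (trans (Xₛ-*ₛ-suc (Xₛ *ₛ P) (suc n)) (Xₛ-*ₛ-suc P n))) (ℚP.+-inverseʳ (P n))

f²≈U*f' : f *ₛ f ≈ₛ U *ₛ deriv f
f²≈U*f' = begin
  f *ₛ f                         ≈⟨ solve 2 (λ a w → a :* a := (a :* a :- w) :+ w) ≈ₛ-refl f (U *ₛ deriv f) ⟩
  W +ₛ U *ₛ deriv f              ≈⟨ +ₛ-congʳ (U *ₛ deriv f) (≈ₛ-trans (Dₛ-cancel W (Dₛ-cancel (Dₛ *ₛ W) D²W≈0)) (≈ₛ-sym constₛ-0)) ⟩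
  constₛ 0ℚ +ₛ U *ₛ deriv f      ≈⟨ solve 1 (λ w → con 0ℚ :+ w := w) ≈ₛ-refl (U *ₛ deriv f) ⟩
  U *ₛ deriv f                   ∎
  where
  open SeriesReasoning
  W = f *ₛ f +ₛ -ₛ (U *ₛ deriv f)
  D²W≈0 : Dₛ *ₛ (Dₛ *ₛ W) ≈ₛ zeroₛ
  D²W≈0 = begin
    Dₛ *ₛ (Dₛ *ₛ W)
      ≈⟨ solve 5 (λ d g g' x p → d :* (d :* (g :* g :+ :- (x :* x :* p :* g'))) := (d :* g) :* (d :* g) :+ :- (x :* x :* (p :* (d :* (d :* g'))))) ≈ₛ-refl Dₛ f (deriv f) Xₛ P ⟩
    (Dₛ *ₛ f) *ₛ (Dₛ *ₛ f) +ₛ -ₛ (Xₛ *ₛ Xₛ *ₛ (P *ₛ (Dₛ *ₛ (Dₛ *ₛ deriv f))))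
      ≈⟨ +ₛ-cong (*ₛ-cong Dₛ*f≈X Dₛ*f≈X) (-ₛ-cong (*ₛ-congˡ (Xₛ *ₛ Xₛ) (≈ₛ-trans (*ₛ-congˡ P D²f'≈Q) P*Q≈1))) ⟩
    Xₛ *ₛ Xₛ +ₛ -ₛ (Xₛ *ₛ Xₛ *ₛ constₛ 1ℚ)
      ≈⟨ solve 1 (λ x → x :* x :+ :- (x :* x :* con 1ℚ) := con 0ℚ) ≈ₛ-refl Xₛ ⟩
    constₛ 0ℚ
      ≈⟨ constₛ-0 ⟩
    zeroₛ ∎

-- P' = 2x P², from (P (1 - x²))' = 0
deriv-P : deriv P ≈ₛ (Xₛ +ₛ Xₛ) *ₛ P *ₛ P
deriv-P = begin
  deriv P
    ≈⟨ solve 4 (λ dp p q dq → dp := p :* (dp :* q :+ p :* dq) :+ :- (p :* p :* dq) :+ dp :* (con 1ℚ :- p :* q)) ≈ₛ-refl (deriv P) P Qₛ (deriv Qₛ) ⟩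
  P *ₛ (deriv P *ₛ Qₛ +ₛ P *ₛ deriv Qₛ) +ₛ -ₛ (P *ₛ P *ₛ deriv Qₛ) +ₛ deriv P *ₛ (constₛ 1ℚ +ₛ -ₛ (P *ₛ Qₛ))
    ≈⟨ +ₛ-cong (+ₛ-cong (*ₛ-congˡ P (≈ₛ-trans (≈ₛ-sym (deriv-leibniz P Qₛ)) (≈ₛ-trans (deriv-cong P*Q≈1) (deriv-const 1ℚ))))
                        (-ₛ-cong (*ₛ-congˡ (P *ₛ P) deriv-Qₛ)))
               (*ₛ-congˡ (deriv P) (+ₛ-congˡ (constₛ 1ℚ) (-ₛ-cong P*Q≈1))) ⟩
  P *ₛ constₛ 0ℚ +ₛ -ₛ (P *ₛ P *ₛ -ₛ (Xₛ +ₛ Xₛ)) +ₛ deriv P *ₛ (constₛ 1ℚ +ₛ -ₛ constₛ 1ℚ)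
    ≈⟨ solve 3 (λ dp p x → p :* con 0ℚ :+ :- (p :* p :* :- (x :+ x)) :+ dp :* (con 1ℚ :- con 1ℚ) := (x :+ x) :* p :* p) ≈ₛ-refl (deriv P) P Xₛ ⟩
  (Xₛ +ₛ Xₛ) *ₛ P *ₛ P ∎
  where open SeriesReasoning

deriv-power : ∀ m → deriv (f ^ₛ suc m) ≈ₛ constₛ (ℕ→ℚ (suc m)) *ₛ (f ^ₛ m *ₛ deriv f)
deriv-power zero = begin
  deriv (f *ₛ oneₛ)                             ≈⟨ deriv-leibniz f oneₛ ⟩
  deriv f *ₛ oneₛ +ₛ f *ₛ deriv oneₛ            ≈⟨ +ₛ-cong (*ₛ-congˡ (deriv f) (≈ₛ-sym constₛ-1)) (*ₛ-congˡ f (≈ₛ-trans (deriv-cong (≈ₛ-sym constₛ-1)) (deriv-const 1ℚ))) ⟩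
  deriv f *ₛ constₛ 1ℚ +ₛ f *ₛ constₛ 0ℚ        ≈⟨ solve 2 (λ g g' → g' :* con 1ℚ :+ g :* con 0ℚ := con 1ℚ :* (con 1ℚ :* g')) ≈ₛ-refl f (deriv f) ⟩
  constₛ 1ℚ *ₛ (constₛ 1ℚ *ₛ deriv f)           ≈⟨ *ₛ-congˡ (constₛ 1ℚ) (*ₛ-congʳ (deriv f) constₛ-1) ⟩
  constₛ (ℕ→ℚ 1) *ₛ (oneₛ *ₛ deriv f)           ∎
  where open SeriesReasoning
deriv-power (suc m) = begin
  deriv (f *ₛ f ^ₛ suc m)
    ≈⟨ deriv-leibniz f (f ^ₛ suc m) ⟩
  deriv f *ₛ f ^ₛ suc m +ₛ f *ₛ deriv (f ^ₛ suc m)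
    ≈⟨ +ₛ-congˡ (deriv f *ₛ f ^ₛ suc m) (*ₛ-congˡ f (deriv-power m)) ⟩
  deriv f *ₛ (f *ₛ f ^ₛ m) +ₛ f *ₛ (constₛ (ℕ→ℚ (suc m)) *ₛ (f ^ₛ m *ₛ deriv f))
    ≈⟨ solve 4 (λ g h c d → d :* (g :* h) :+ g :* (c :* (h :* d)) := (con 1ℚ :+ c) :* (g :* h :* d)) ≈ₛ-refl f (f ^ₛ m) (constₛ (ℕ→ℚ (suc m))) (deriv f) ⟩
  (constₛ 1ℚ +ₛ constₛ (ℕ→ℚ (suc m))) *ₛ (f ^ₛ suc m *ₛ deriv f)
    ≈⟨ *ₛ-congʳ (f ^ₛ suc m *ₛ deriv f) (≈ₛ-sym (≈ₛ-trans (≡⇒≈ₛ (cong constₛ (ℕ→ℚ-suc (suc m)))) (constₛ-+ 1ℚ (ℕ→ℚ (suc m))))) ⟩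
  constₛ (ℕ→ℚ (suc (suc m))) *ₛ (f ^ₛ suc m *ₛ deriv f) ∎
  where open SeriesReasoning

power-step : ∀ m → f ^ₛ suc (suc m) ≈ₛ constₛ (recipℕ (suc m)) *ₛ (U *ₛ deriv (f ^ₛ suc m))
power-step m = ≈ₛ-sym (begin
  r *ₛ (U *ₛ deriv (f ^ₛ suc m))        ≈⟨ *ₛ-congˡ r (*ₛ-congˡ U (deriv-power m)) ⟩
  r *ₛ (U *ₛ (c *ₛ (f ^ₛ m *ₛ deriv f)))  ≈⟨ solve 5 (λ r c u g d → r :* (u :* (c :* (g :* d))) := (r :* c) :* g :* (u :* d)) ≈ₛ-refl r c U (f ^ₛ m) (deriv f) ⟩
  (r *ₛ c) *ₛ f ^ₛ m *ₛ (U *ₛ deriv f)   ≈⟨ *ₛ-cong (*ₛ-congʳ (f ^ₛ m) r*c≈1) (≈ₛ-sym f²≈U*f') ⟩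
  constₛ 1ℚ *ₛ f ^ₛ m *ₛ (f *ₛ f)       ≈⟨ solve 2 (λ g h → con 1ℚ :* g :* (h :* h) := h :* (h :* g)) ≈ₛ-refl (f ^ₛ m) f ⟩
  f ^ₛ suc (suc m)                      ∎)
  where
  open SeriesReasoning
  r = constₛ (recipℕ (suc m))
  c = constₛ (ℕ→ℚ (suc m))
  r*c≈1 : r *ₛ c ≈ₛ constₛ 1ℚ
  r*c≈1 = ≈ₛ-trans (≈ₛ-sym (constₛ-* (recipℕ (suc m)) (ℕ→ℚ (suc m))))
                   (≡⇒≈ₛ (cong constₛ (recipℕ-inverse m)))

Σₛ : ℕ → (ℕ → Series) → Series
Σₛ zero g = zeroₛ
Σₛ (suc N) g = g 0 +ₛ Σₛ N (λ i → g (suc i))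

sumₛ-applyUpTo : ∀ (g : ℕ → Series) h N → sumₛ (map g (applyUpTo h N)) ≈ₛ Σₛ N (λ i → g (h i))
sumₛ-applyUpTo g h zero = ≈ₛ-refl
sumₛ-applyUpTo g h (suc N) = +ₛ-congˡ (g (h 0)) (sumₛ-applyUpTo g (λ i → h (suc i)) N)

Σₛ-cong : ∀ N {g h : ℕ → Series} → (∀ i → i < N → g i ≈ₛ h i) → Σₛ N g ≈ₛ Σₛ N h
Σₛ-cong zero e = ≈ₛ-refl
Σₛ-cong (suc N) e = +ₛ-cong (e 0 (s≤s z≤n)) (Σₛ-cong N (λ i i<N → e (suc i) (s≤s i<N)))

Σₛ-+ : ∀ N (g h : ℕ → Series) → Σₛ N (λ i → g i +ₛ h i) ≈ₛ Σₛ N g +ₛ Σₛ N h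
Σₛ-+ zero g h n = sym (ℚP.+-identityʳ 0ℚ)
Σₛ-+ (suc N) g h = ≈ₛ-trans (+ₛ-congˡ (g 0 +ₛ h 0) (Σₛ-+ N (λ i → g (suc i)) (λ i → h (suc i))))
  (solve 4 (λ a b c d → a :+ b :+ (c :+ d) := a :+ c :+ (b :+ d)) ≈ₛ-refl (g 0) (h 0) (Σₛ N (λ i → g (suc i))) (Σₛ N (λ i → h (suc i))))
  where open SeriesReasoning

Σₛ-zero : ∀ N (g : ℕ → Series) → (∀ i → g i ≈ₛ zeroₛ) → Σₛ N g ≈ₛ zeroₛ
Σₛ-zero zero g e = ≈ₛ-refl
Σₛ-zero (suc N) g e n = trans (cong₂ _+_ (e 0 n) (Σₛ-zero N (λ i → g (suc i)) (λ i → e (suc i)) n)) (ℚP.+-identityʳ 0ℚ)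

Σₛ-dropLast : ∀ N (g : ℕ → Series) → g N ≈ₛ zeroₛ → Σₛ (suc N) g ≈ₛ Σₛ N g
Σₛ-dropLast zero g e n = trans (cong (_+ 0ℚ) (e n)) (ℚP.+-identityʳ 0ℚ)
Σₛ-dropLast (suc N) g e = +ₛ-congˡ (g 0) (Σₛ-dropLast N (λ i → g (suc i)) e)

Σₛ-dropFirst : ∀ N (g : ℕ → Series) → g 0 ≈ₛ zeroₛ → Σₛ (suc N) g ≈ₛ Σₛ N (λ i → g (suc i))
Σₛ-dropFirst N g e n = trans (cong (_+ Σₛ N (λ i → g (suc i)) n) (e n)) (ℚP.+-identityˡ _)

Σₛ-truncate : ∀ K t (g : ℕ → Series) → (∀ j → K ≤ j → g j ≈ₛ zeroₛ) → Σₛ (K ℕ.+ t) g ≈ₛ Σₛ K g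
Σₛ-truncate K zero g z = ≡⇒≈ₛ (cong (λ x → Σₛ x g) (ℕP.+-identityʳ K))
Σₛ-truncate K (suc t) g z = ≈ₛ-trans (≡⇒≈ₛ (cong (λ x → Σₛ x g) (ℕP.+-suc K t)))
  (≈ₛ-trans (Σₛ-dropLast (K ℕ.+ t) g (z (K ℕ.+ t) (ℕP.m≤m+n K t))) (Σₛ-truncate K t g z))

*ₛ-Σₛ : ∀ N (q : Series) (g : ℕ → Series) → q *ₛ Σₛ N g ≈ₛ Σₛ N (λ i → q *ₛ g i)
*ₛ-Σₛ zero q g = ≈ₛ-trans (*ₛ-comm q zeroₛ) (*ₛ-zeroˡ q)
*ₛ-Σₛ (suc N) q g = ≈ₛ-trans (*ₛ-distribˡ q (g 0) (Σₛ N (λ i → g (suc i)))) (+ₛ-congˡ (q *ₛ g 0) (*ₛ-Σₛ N q (λ i → g (suc i))))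

Σₛ-*ₛ : ∀ N (g : ℕ → Series) (q : Series) → Σₛ N g *ₛ q ≈ₛ Σₛ N (λ i → g i *ₛ q)
Σₛ-*ₛ N g q = ≈ₛ-trans (*ₛ-comm (Σₛ N g) q) (≈ₛ-trans (*ₛ-Σₛ N q g) (Σₛ-cong N (λ i _ → *ₛ-comm q (g i))))

deriv-Σₛ : ∀ N (g : ℕ → Series) → deriv (Σₛ N g) ≈ₛ Σₛ N (λ i → deriv (g i))
deriv-Σₛ zero g n = ℚP.*-zeroʳ (ℕ→ℚ (suc n))
deriv-Σₛ (suc N) g = ≈ₛ-trans (deriv-+ (g 0) (Σₛ N (λ i → g (suc i)))) (+ₛ-congˡ (deriv (g 0)) (deriv-Σₛ N (λ i → g (suc i))))

monomial : ℕ → ℕ → Series → Series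
monomial a b G = Xₛ ^ₛ a *ₛ (P ^ₛ b *ₛ G)

constₛ-suc : ∀ m → constₛ (ℕ→ℚ (suc m)) ≈ₛ constₛ 1ℚ +ₛ constₛ (ℕ→ℚ m)
constₛ-suc m = ≈ₛ-trans (≡⇒≈ₛ (cong constₛ (ℕ→ℚ-suc m))) (constₛ-+ 1ℚ (ℕ→ℚ m))

euler-power : ∀ a → Xₛ *ₛ deriv (Xₛ ^ₛ a) ≈ₛ constₛ (ℕ→ℚ a) *ₛ Xₛ ^ₛ a
euler-power zero = begin
  Xₛ *ₛ deriv oneₛ                ≈⟨ *ₛ-congˡ Xₛ (≈ₛ-trans (deriv-cong (≈ₛ-sym constₛ-1)) (deriv-const 1ℚ)) ⟩
  Xₛ *ₛ constₛ 0ℚ                 ≈⟨ solve 1 (λ x → x :* con 0ℚ := con 0ℚ :* con 1ℚ) ≈ₛ-refl Xₛ ⟩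
  constₛ 0ℚ *ₛ constₛ 1ℚ          ≈⟨ *ₛ-congˡ (constₛ 0ℚ) constₛ-1 ⟩
  constₛ (ℕ→ℚ 0) *ₛ oneₛ          ∎
  where open SeriesReasoning
euler-power (suc a) = begin
  Xₛ *ₛ deriv (Xₛ *ₛ Xₛ ^ₛ a)
    ≈⟨ *ₛ-congˡ Xₛ (≈ₛ-trans (deriv-leibniz Xₛ (Xₛ ^ₛ a)) (+ₛ-congʳ (Xₛ *ₛ deriv (Xₛ ^ₛ a)) (*ₛ-congʳ (Xₛ ^ₛ a) deriv-Xₛ))) ⟩
  Xₛ *ₛ (constₛ 1ℚ *ₛ Xₛ ^ₛ a +ₛ Xₛ *ₛ deriv (Xₛ ^ₛ a))
    ≈⟨ solve 3 (λ x g d → x :* (con 1ℚ :* g :+ x :* d) := x :* g :+ x :* (x :* d)) ≈ₛ-refl Xₛ (Xₛ ^ₛ a) (deriv (Xₛ ^ₛ a)) ⟩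
  Xₛ *ₛ Xₛ ^ₛ a +ₛ Xₛ *ₛ (Xₛ *ₛ deriv (Xₛ ^ₛ a))
    ≈⟨ +ₛ-congˡ (Xₛ *ₛ Xₛ ^ₛ a) (*ₛ-congˡ Xₛ (euler-power a)) ⟩
  Xₛ *ₛ Xₛ ^ₛ a +ₛ Xₛ *ₛ (constₛ (ℕ→ℚ a) *ₛ Xₛ ^ₛ a)
    ≈⟨ solve 3 (λ x g c → x :* g :+ x :* (c :* g) := (con 1ℚ :+ c) :* (x :* g)) ≈ₛ-refl Xₛ (Xₛ ^ₛ a) (constₛ (ℕ→ℚ a)) ⟩
  (constₛ 1ℚ +ₛ constₛ (ℕ→ℚ a)) *ₛ Xₛ ^ₛ suc a
    ≈⟨ *ₛ-congʳ (Xₛ ^ₛ suc a) (constₛ-suc a) ⟨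
  constₛ (ℕ→ℚ (suc a)) *ₛ Xₛ ^ₛ suc a ∎
  where open SeriesReasoning

deriv-P^ : ∀ b → deriv (P ^ₛ b) ≈ₛ constₛ (ℕ→ℚ b) *ₛ (Xₛ +ₛ Xₛ) *ₛ P ^ₛ suc b
deriv-P^ zero = begin
  deriv oneₛ                            ≈⟨ ≈ₛ-trans (deriv-cong (≈ₛ-sym constₛ-1)) (deriv-const 1ℚ) ⟩
  constₛ 0ℚ                             ≈⟨ solve 2 (λ x p → con 0ℚ := con 0ℚ :* (x :+ x) :* (p :* con 1ℚ)) ≈ₛ-refl Xₛ P ⟩
  constₛ 0ℚ *ₛ (Xₛ +ₛ Xₛ) *ₛ (P *ₛ constₛ 1ℚ)  ≈⟨ *ₛ-congˡ (constₛ 0ℚ *ₛ (Xₛ +ₛ Xₛ)) (*ₛ-congˡ P constₛ-1) ⟩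
  constₛ (ℕ→ℚ 0) *ₛ (Xₛ +ₛ Xₛ) *ₛ P ^ₛ 1     ∎
  where open SeriesReasoning
deriv-P^ (suc b) = begin
  deriv (P *ₛ P ^ₛ b)
    ≈⟨ deriv-leibniz P (P ^ₛ b) ⟩
  deriv P *ₛ P ^ₛ b +ₛ P *ₛ deriv (P ^ₛ b)
    ≈⟨ +ₛ-cong (*ₛ-congʳ (P ^ₛ b) deriv-P) (*ₛ-congˡ P (deriv-P^ b)) ⟩
  (Xₛ +ₛ Xₛ) *ₛ P *ₛ P *ₛ P ^ₛ b +ₛ P *ₛ (constₛ (ℕ→ℚ b) *ₛ (Xₛ +ₛ Xₛ) *ₛ P ^ₛ suc b)
    ≈⟨ solve 4 (λ x p g c → (x :+ x) :* p :* p :* g :+ p :* (c :* (x :+ x) :* (p :* g)) := (con 1ℚ :+ c) :* (x :+ x) :* (p :* (p :* g))) ≈ₛ-refl Xₛ P (P ^ₛ b) (constₛ (ℕ→ℚ b)) ⟩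
  (constₛ 1ℚ +ₛ constₛ (ℕ→ℚ b)) *ₛ (Xₛ +ₛ Xₛ) *ₛ P ^ₛ suc (suc b)
    ≈⟨ *ₛ-congʳ (P ^ₛ suc (suc b)) (*ₛ-congʳ (Xₛ +ₛ Xₛ) (constₛ-suc b)) ⟨
  constₛ (ℕ→ℚ (suc b)) *ₛ (Xₛ +ₛ Xₛ) *ₛ P ^ₛ suc (suc b) ∎
  where open SeriesReasoning

stepCoefficient : ℕ → ℕ → ℚ
stepCoefficient a b = ℕ→ℚ b + ℕ→ℚ b - ℕ→ℚ a

U-deriv-monomial : ∀ a b G → U *ₛ deriv (monomial a b G) ≈ₛ
  constₛ (ℕ→ℚ a) *ₛ monomial (suc a) (2 ℕ.+ b) G
    +ₛ constₛ (stepCoefficient a b) *ₛ monomial (3 ℕ.+ a) (2 ℕ.+ b) G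
    +ₛ monomial (2 ℕ.+ a) (suc b) (deriv G)
U-deriv-monomial a b G = begin
  U *ₛ deriv (xa *ₛ (pb *ₛ G))
    ≈⟨ *ₛ-congˡ U (≈ₛ-trans (deriv-leibniz xa (pb *ₛ G)) (+ₛ-congˡ (deriv xa *ₛ (pb *ₛ G)) (*ₛ-congˡ xa (deriv-leibniz pb G)))) ⟩
  U *ₛ (deriv xa *ₛ (pb *ₛ G) +ₛ xa *ₛ (deriv pb *ₛ G +ₛ pb *ₛ deriv G))
    ≈⟨ solve 8 (λ x p xa dxa pb dpb g dg →
         x :* x :* p :* (dxa :* (pb :* g) :+ xa :* (dpb :* g :+ pb :* dg))
           := (x :* dxa) :* x :* p :* pb :* g :+ x :* x :* p :* xa :* dpb :* g :+ x :* x :* p :* xa :* pb :* dg)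
         ≈ₛ-refl Xₛ P xa (deriv xa) pb (deriv pb) G (deriv G) ⟩
  (Xₛ *ₛ deriv xa) *ₛ Xₛ *ₛ P *ₛ pb *ₛ G +ₛ U *ₛ xa *ₛ deriv pb *ₛ G +ₛ U *ₛ xa *ₛ pb *ₛ deriv G
    ≈⟨ +ₛ-congʳ (U *ₛ xa *ₛ pb *ₛ deriv G)
         (+ₛ-cong (*ₛ-congʳ G (*ₛ-congʳ pb (*ₛ-cong (*ₛ-congʳ Xₛ (euler-power a)) P≈P²Q)))
                  (*ₛ-congʳ G (*ₛ-congˡ (U *ₛ xa) (deriv-P^ b)))) ⟩
  ca *ₛ xa *ₛ Xₛ *ₛ (P *ₛ (P *ₛ Qₛ)) *ₛ pb *ₛ G +ₛ U *ₛ xa *ₛ (cb *ₛ (Xₛ +ₛ Xₛ) *ₛ (P *ₛ pb)) *ₛ G +ₛ U *ₛ xa *ₛ pb *ₛ deriv G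
    ≈⟨ solve 8 (λ x p xa pb g dg ca cb →
         ca :* xa :* x :* (p :* (p :* (con 1ℚ :- x :* x))) :* pb :* g
           :+ x :* x :* p :* xa :* (cb :* (x :+ x) :* (p :* pb)) :* g
           :+ x :* x :* p :* xa :* pb :* dg
         := ca :* (x :* xa :* (p :* (p :* pb) :* g))
           :+ (cb :+ cb :- ca) :* (x :* (x :* (x :* xa)) :* (p :* (p :* pb) :* g))
           :+ x :* (x :* xa) :* (p :* pb :* dg))
         ≈ₛ-refl Xₛ P xa pb G (deriv G) ca cb ⟩
  ca *ₛ monomial (suc a) (2 ℕ.+ b) G +ₛ (cb +ₛ cb +ₛ -ₛ ca) *ₛ monomial (3 ℕ.+ a) (2 ℕ.+ b) G +ₛ monomial (2 ℕ.+ a) (suc b) (deriv G)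
    ≈⟨ +ₛ-congʳ (monomial (2 ℕ.+ a) (suc b) (deriv G)) (+ₛ-congˡ (ca *ₛ monomial (suc a) (2 ℕ.+ b) G)
         (*ₛ-congʳ (monomial (3 ℕ.+ a) (2 ℕ.+ b) G) (≈ₛ-sym constₛ-stepCoefficient))) ⟩
  constₛ (ℕ→ℚ a) *ₛ monomial (suc a) (2 ℕ.+ b) G +ₛ constₛ (stepCoefficient a b) *ₛ monomial (3 ℕ.+ a) (2 ℕ.+ b) G +ₛ monomial (2 ℕ.+ a) (suc b) (deriv G) ∎
  where
  open SeriesReasoning
  xa = Xₛ ^ₛ a
  pb = P ^ₛ b
  ca = constₛ (ℕ→ℚ a)
  cb = constₛ (ℕ→ℚ b)
  -- P = P² (1 - x²), inserted to raise the power of P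
  P≈P²Q : P ≈ₛ P *ₛ (P *ₛ Qₛ)
  P≈P²Q = ≈ₛ-trans (solve 1 (λ p → p := p :* con 1ℚ) ≈ₛ-refl P) (*ₛ-congˡ P (≈ₛ-sym P*Q≈1))
  constₛ-stepCoefficient : constₛ (stepCoefficient a b) ≈ₛ cb +ₛ cb +ₛ -ₛ ca
  constₛ-stepCoefficient = ≈ₛ-trans (constₛ-+ (ℕ→ℚ b + ℕ→ℚ b) (- ℕ→ℚ a)) (+ₛ-cong (constₛ-+ (ℕ→ℚ b) (ℕ→ℚ b)) (constₛ-neg (ℕ→ℚ a)))

binom : ℕ → ℕ → ℕ
binom zero zero = 1
binom zero (suc k) = 0
binom (suc n) zero = 1
binom (suc n) (suc k) = binom n k ℕ.+ binom n (suc k)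

C≡binom : ∀ n k → n C k ≡ binom n k
C≡binom zero zero = refl
C≡binom zero (suc k) = refl
C≡binom (suc n) zero = refl
C≡binom (suc n) (suc k) = trans (sym (nCk+nC[k+1]≡[n+1]C[k+1] n k)) (cong₂ ℕ._+_ (C≡binom n k) (C≡binom n (suc k)))

binom-0 : ∀ n → binom n 0 ≡ 1
binom-0 zero = refl
binom-0 (suc n) = refl

binom-1 : ∀ n → binom n 1 ≡ n
binom-1 zero = refl
binom-1 (suc n) = cong₂ ℕ._+_ (binom-0 n) (binom-1 n)

binom-above : ∀ {n k} → n < k → binom n k ≡ 0
binom-above {zero} {suc k} _ = refl
binom-above {suc n} {suc k} (s≤s n<k) = cong₂ ℕ._+_ (binom-above n<k) (binom-above (ℕP.m<n⇒m<1+n n<k))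

absorption : ∀ n k → suc k ℕ.* binom n (suc k) ≡ (n ∸ k) ℕ.* binom n k
absorption zero k = trans (ℕP.*-zeroʳ (suc k)) (sym (cong (ℕ._* binom 0 k) (ℕP.0∸n≡0 k)))
absorption (suc n) zero = trans (ℕP.*-identityˡ (binom (suc n) 1)) (trans (binom-1 (suc n)) (sym (ℕP.*-identityʳ (suc n))))
absorption (suc n) (suc k) with k ℕP.<? n
... | yes k<n = begin
  (2 ℕ.+ k) ℕ.* (c₁ ℕ.+ c₂)                   ≡⟨ ℕS.solve 3 (λ k a b → (con 2 :+ k) :* (a :+ b) := (con 1 :+ k) :* a :+ a :+ (con 2 :+ k) :* b) refl k c₁ c₂ ⟩
  suc k ℕ.* c₁ ℕ.+ c₁ ℕ.+ (2 ℕ.+ k) ℕ.* c₂     ≡⟨ cong₂ (λ u v → u ℕ.+ c₁ ℕ.+ v) (absorption n k) (absorption n (suc k)) ⟩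
  (n ∸ k) ℕ.* c₀ ℕ.+ c₁ ℕ.+ d ℕ.* c₁          ≡⟨ cong (λ z → z ℕ.* c₀ ℕ.+ c₁ ℕ.+ d ℕ.* c₁) n∸k≡1+d ⟩
  suc d ℕ.* c₀ ℕ.+ c₁ ℕ.+ d ℕ.* c₁            ≡⟨ ℕS.solve 3 (λ d a b → (con 1 :+ d) :* a :+ b :+ d :* b := (con 1 :+ d) :* (a :+ b)) refl d c₀ c₁ ⟩
  suc d ℕ.* (c₀ ℕ.+ c₁)                       ≡⟨ cong (ℕ._* (c₀ ℕ.+ c₁)) n∸k≡1+d ⟨
  (n ∸ k) ℕ.* (c₀ ℕ.+ c₁)                     ∎
  where
  open ≡-Reasoning
  open ℕS
  c₀ = binom n k
  c₁ = binom n (suc k)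
  c₂ = binom n (suc (suc k))
  d = n ∸ suc k
  n∸k≡1+d : n ∸ k ≡ suc d
  n∸k≡1+d = ℕP.+-∸-assoc 1 k<n
... | no k≮n = begin
  (2 ℕ.+ k) ℕ.* (binom n (suc k) ℕ.+ binom n (suc (suc k)))  ≡⟨ cong₂ (λ u v → (2 ℕ.+ k) ℕ.* (u ℕ.+ v)) (binom-above (s≤s n≤k)) (binom-above (s≤s (ℕP.m≤n⇒m≤1+n n≤k))) ⟩
  (2 ℕ.+ k) ℕ.* 0                                             ≡⟨ ℕP.*-zeroʳ (2 ℕ.+ k) ⟩
  0                                                           ≡⟨ cong (ℕ._* (binom n k ℕ.+ binom n (suc k))) (ℕP.m≤n⇒m∸n≡0 n≤k) ⟨
  (n ∸ k) ℕ.* (binom n k ℕ.+ binom n (suc k))                 ∎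
  where
  open ≡-Reasoning
  n≤k : n ≤ k
  n≤k = ℕP.≮⇒≥ k≮n

absorption-suc : ∀ n k → suc k ℕ.* binom (suc n) (suc k) ≡ suc n ℕ.* binom n k
absorption-suc n k with k ℕP.≤? n
... | yes k≤n = begin
  suc k ℕ.* (binom n k ℕ.+ binom n (suc k))          ≡⟨ ℕP.*-distribˡ-+ (suc k) (binom n k) (binom n (suc k)) ⟩
  suc k ℕ.* binom n k ℕ.+ suc k ℕ.* binom n (suc k)  ≡⟨ cong (suc k ℕ.* binom n k ℕ.+_) (absorption n k) ⟩
  suc k ℕ.* binom n k ℕ.+ (n ∸ k) ℕ.* binom n k      ≡⟨ ℕP.*-distribʳ-+ (binom n k) (suc k) (n ∸ k) ⟨
  (suc k ℕ.+ (n ∸ k)) ℕ.* binom n k                  ≡⟨ cong (λ z → suc z ℕ.* binom n k) (ℕP.m+[n∸m]≡n k≤n) ⟩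
  suc n ℕ.* binom n k                                ∎
  where open ≡-Reasoning
... | no k≰n = begin
  suc k ℕ.* (binom n k ℕ.+ binom n (suc k))  ≡⟨ cong₂ (λ u v → suc k ℕ.* (u ℕ.+ v)) (binom-above n<k) (binom-above (ℕP.m<n⇒m<1+n n<k)) ⟩
  suc k ℕ.* 0                                ≡⟨ ℕP.*-zeroʳ (suc k) ⟩
  0                                          ≡⟨ ℕP.*-zeroʳ (suc n) ⟨
  suc n ℕ.* 0                                ≡⟨ cong (suc n ℕ.*_) (binom-above n<k) ⟨
  suc n ℕ.* binom n k                        ∎
  where
  open ≡-Reasoning
  n<k : n < k
  n<k = ℕP.≰⇒> k≰n

-- The part of C(k, j) coming from C(k - 1, j - 1) in Pascal's rule (0 for j = 0).
binomBelow : ℕ → ℕ → ℕ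
binomBelow k zero = 0
binomBelow k (suc j) = binom (k ∸ 1) j

binom-split : ∀ {k j} → j ≤ k → binom k j ≡ binom (k ∸ 1) j ℕ.+ binomBelow k j
binom-split {zero} {zero} _ = refl
binom-split {suc k} {zero} _ = sym (trans (ℕP.+-identityʳ (binom k 0)) (binom-0 k))
binom-split {suc k} {suc j} _ = ℕP.+-comm (binom k j) (binom k (suc j))

binom-ratio : ∀ {k j} → j ≤ k → j ℕ.* binom (k ∸ 1) j ≡ (k ∸ j) ℕ.* binomBelow k j
binom-ratio {k} {zero} _ = sym (ℕP.*-zeroʳ k)
binom-ratio {suc k} {suc j} _ = absorption k j

-- The polynomial identity behind the coefficient recurrence: for N = i + j + M + 1,
-- given the two absorption relations (i + 1) δ = (N - i) γ and j α = i β,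
--   N (α + β)(γ + δ) = (α + β) δ M + (2N + 2j - k) α γ + (3k - 2j + 2) β δ,
-- where k = i + j, 2N + 2j - k = i + 3j + 2M + 2 and 3k - 2j + 2 = 3i + j + 2.
-- The difference of the two sides is (α - β)((i+1)δ - (N-i)γ) + (δ - γ)(jα - iβ);
-- to stay in ℕ the products of this expansion are added to both sides and cancelled.
binomial-identity : ∀ i j M α β γ δ → suc i ℕ.* δ ≡ suc (j ℕ.+ M) ℕ.* γ → j ℕ.* α ≡ i ℕ.* β →
  suc (i ℕ.+ j ℕ.+ M) ℕ.* ((α ℕ.+ β) ℕ.* (γ ℕ.+ δ)) ≡
    (α ℕ.+ β) ℕ.* δ ℕ.* M ℕ.+ (i ℕ.+ 3 ℕ.* j ℕ.+ 2 ℕ.* M ℕ.+ 2) ℕ.* (α ℕ.* γ) ℕ.+ (3 ℕ.* i ℕ.+ j ℕ.+ 2) ℕ.* (β ℕ.* δ)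
binomial-identity i j M α β γ δ r s = ℕP.+-cancelʳ-≡ E _ _ (begin
  L ℕ.+ E
    ≡⟨ ℕS.solve 7 (λ i j M a b g d →
         (con 1 :+ (i :+ j :+ M)) :* ((a :+ b) :* (g :+ d))
           :+ (a :* ((con 1 :+ (j :+ M)) :* g) :+ b :* ((con 1 :+ i) :* d) :+ d :* (i :* b) :+ g :* (j :* a))
         := (a :+ b) :* d :* M :+ (i :+ con 3 :* j :+ con 2 :* M :+ con 2) :* (a :* g) :+ (con 3 :* i :+ j :+ con 2) :* (b :* d)
           :+ (a :* ((con 1 :+ i) :* d) :+ b :* ((con 1 :+ (j :+ M)) :* g) :+ d :* (j :* a) :+ g :* (i :* b)))
         refl i j M α β γ δ ⟩
  R ℕ.+ (α ℕ.* (suc i ℕ.* δ) ℕ.+ β ℕ.* (suc (j ℕ.+ M) ℕ.* γ) ℕ.+ δ ℕ.* (j ℕ.* α) ℕ.+ γ ℕ.* (i ℕ.* β))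
    ≡⟨ cong₂ (λ x y → R ℕ.+ (α ℕ.* x ℕ.+ β ℕ.* y ℕ.+ δ ℕ.* (j ℕ.* α) ℕ.+ γ ℕ.* (i ℕ.* β))) r (sym r) ⟩
  R ℕ.+ (α ℕ.* (suc (j ℕ.+ M) ℕ.* γ) ℕ.+ β ℕ.* (suc i ℕ.* δ) ℕ.+ δ ℕ.* (j ℕ.* α) ℕ.+ γ ℕ.* (i ℕ.* β))
    ≡⟨ cong₂ (λ x y → R ℕ.+ (α ℕ.* (suc (j ℕ.+ M) ℕ.* γ) ℕ.+ β ℕ.* (suc i ℕ.* δ) ℕ.+ δ ℕ.* x ℕ.+ γ ℕ.* y)) s (sym s) ⟩
  R ℕ.+ E ∎)
  where
  open ≡-Reasoning
  open ℕS
  L = suc (i ℕ.+ j ℕ.+ M) ℕ.* ((α ℕ.+ β) ℕ.* (γ ℕ.+ δ))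
  R = (α ℕ.+ β) ℕ.* δ ℕ.* M ℕ.+ (i ℕ.+ 3 ℕ.* j ℕ.+ 2 ℕ.* M ℕ.+ 2) ℕ.* (α ℕ.* γ) ℕ.+ (3 ℕ.* i ℕ.+ j ℕ.+ 2) ℕ.* (β ℕ.* δ)
  E = α ℕ.* (suc (j ℕ.+ M) ℕ.* γ) ℕ.+ β ℕ.* (suc i ℕ.* δ) ℕ.+ δ ℕ.* (i ℕ.* β) ℕ.+ γ ℕ.* (j ℕ.* α)

ℕ→ℚ-identity : ∀ {N X Y A Z B W} → N ℕ.* X ≡ Y ℕ.+ A ℕ.* Z ℕ.+ B ℕ.* W →
  ℕ→ℚ N * ℕ→ℚ X ≡ ℕ→ℚ Y + ℕ→ℚ A * ℕ→ℚ Z + ℕ→ℚ B * ℕ→ℚ W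
ℕ→ℚ-identity {N} {X} {Y} {A} {Z} {B} {W} e = begin
  ℕ→ℚ N * ℕ→ℚ X                                ≡⟨ ℕ→ℚ-* N X ⟨
  ℕ→ℚ (N ℕ.* X)                                ≡⟨ cong ℕ→ℚ e ⟩
  ℕ→ℚ (Y ℕ.+ A ℕ.* Z ℕ.+ B ℕ.* W)              ≡⟨ ℕ→ℚ-+ (Y ℕ.+ A ℕ.* Z) (B ℕ.* W) ⟩
  ℕ→ℚ (Y ℕ.+ A ℕ.* Z) + ℕ→ℚ (B ℕ.* W)          ≡⟨ cong₂ _+_ (trans (ℕ→ℚ-+ Y (A ℕ.* Z)) (cong (ℕ→ℚ Y +_) (ℕ→ℚ-* A Z))) (ℕ→ℚ-* B W) ⟩
  ℕ→ℚ Y + ℕ→ℚ A * ℕ→ℚ Z + ℕ→ℚ B * ℕ→ℚ W        ∎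
  where open ≡-Reasoning

stepCoefficient-ℕ : ∀ a b c → b ℕ.+ b ≡ a ℕ.+ c → stepCoefficient a b ≡ ℕ→ℚ c
stepCoefficient-ℕ a b c e = begin
  ℕ→ℚ b + ℕ→ℚ b - ℕ→ℚ a         ≡⟨ cong (_- ℕ→ℚ a) (trans (sym (ℕ→ℚ-+ b b)) (trans (cong ℕ→ℚ e) (ℕ→ℚ-+ a c))) ⟩
  ℕ→ℚ a + ℕ→ℚ c - ℕ→ℚ a         ≡⟨ ℚS.solve 2 (λ x y → x :+ y :- x := y) refl (ℕ→ℚ a) (ℕ→ℚ c) ⟩
  ℕ→ℚ c                         ∎
  where open ≡-Reasoning
        open ℚS

-- The normal form of f^{n+1} (built later) is
--   Σ_{k, j ≤ n} c(n,k,j) x^{2n + 2j - k} P^{n+k} f^{(n-k)},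
-- where c(0,0,0) = 1 and, for n ≥ 1,
--   c(n,k,j) = C(k-1, j) C(n, k-j) (n-k) / (n (n-k)!).

xExponent : ℕ → ℕ → ℕ → ℕ
xExponent n k j = (n ℕ.+ n ℕ.+ (j ℕ.+ j)) ∸ k

binomPart : ℕ → ℕ → ℕ → ℕ
binomPart n k j = binom (k ∸ 1) j ℕ.* binom n (k ∸ j)

-- c(n, k, j); for n ≥ 1 the factor n - k makes the terms with k ≥ n vanish
coeff : ℕ → ℕ → ℕ → ℚ
coeff zero zero zero = 1ℚ
coeff zero zero (suc j) = 0ℚ
coeff zero (suc k) j = 0ℚ
coeff (suc n) k j = ℕ→ℚ (binomPart (suc n) k j ℕ.* (suc n ∸ k)) * recipℕ (suc n ℕ.* (suc n ∸ k) !)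

-- U d/dx sends the (k, j) term of f^{n+1} to terms (k+1, j), (k+1, j+1) and (k, j)
-- (U-deriv-monomial); these are the contributions to the (K, j) term from the
-- first two kinds
coeffA : ℕ → ℕ → ℕ → ℚ
coeffA n zero j = 0ℚ
coeffA n (suc k) j = ℕ→ℚ (xExponent n k j) * coeff n k j

coeffB : ℕ → ℕ → ℕ → ℚ
coeffB n zero j = 0ℚ
coeffB n (suc k) zero = 0ℚ
coeffB n (suc k) (suc j) = stepCoefficient (xExponent n k j) (n ℕ.+ k) * coeff n k j

-- the recurrence that makes U (normal form of f^{n+1})' = (n+1) (normal form of f^{n+2})
Recurrence : ℕ → ℕ → ℕ → Set
Recurrence n K j = ℕ→ℚ (suc n) * coeff (suc n) K j ≡ coeff n K j + coeffA n K j + coeffB n K j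

lowerTerm : ℕ → ℕ → ℕ → ℚ
lowerTerm N k zero = 0ℚ
lowerTerm N k (suc j) = stepCoefficient (xExponent N k j) (N ℕ.+ k) * ℕ→ℚ (binomPart N k j)

NumeratorIdentity : ℕ → ℕ → ℕ → Set
NumeratorIdentity k M j =
  ℕ→ℚ N * ℕ→ℚ (binomPart (suc N) (suc k) j) ≡
    ℕ→ℚ (binomPart N (suc k) j ℕ.* M) + ℕ→ℚ (xExponent N k j) * ℕ→ℚ (binomPart N k j) + lowerTerm N k j
  where N = suc (k ℕ.+ M)

lowerTerm-form : ∀ i j M → let N = suc (i ℕ.+ j ℕ.+ M) in
  lowerTerm N (i ℕ.+ j) j ≡ ℕ→ℚ (3 ℕ.* i ℕ.+ j ℕ.+ 2) * ℕ→ℚ (binomBelow (i ℕ.+ j) j ℕ.* binom N (suc i))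
lowerTerm-form i zero M = sym (ℚP.*-zeroʳ (ℕ→ℚ (3 ℕ.* i ℕ.+ 0 ℕ.+ 2)))
lowerTerm-form i (suc j) M = cong₂ _*_
  (stepCoefficient-ℕ (xExponent N k j) (N ℕ.+ k) (3 ℕ.* i ℕ.+ suc j ℕ.+ 2) twice-sum)
  (cong (λ x → ℕ→ℚ (binom (k ∸ 1) j ℕ.* binom N x)) k∸j≡1+i)
  where
  open ℕS
  k = i ℕ.+ suc j
  N = suc (k ℕ.+ M)
  k∸j≡1+i : k ∸ j ≡ suc i
  k∸j≡1+i = trans (cong (_∸ j) (ℕP.+-suc i j)) (ℕP.m+n∸n≡m (suc i) j)
  exponent : xExponent N k j ≡ i ℕ.+ 3 ℕ.* j ℕ.+ 2 ℕ.* M ℕ.+ 3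
  exponent = trans (cong (_∸ k) (ℕS.solve 3 (λ i j M →
      (con 1 :+ (i :+ (con 1 :+ j) :+ M)) :+ (con 1 :+ (i :+ (con 1 :+ j) :+ M)) :+ (j :+ j)
        := (i :+ con 3 :* j :+ con 2 :* M :+ con 3) :+ (i :+ (con 1 :+ j))) refl i j M))
    (ℕP.m+n∸n≡m (i ℕ.+ 3 ℕ.* j ℕ.+ 2 ℕ.* M ℕ.+ 3) k)
  twice-sum : N ℕ.+ k ℕ.+ (N ℕ.+ k) ≡ xExponent N k j ℕ.+ (3 ℕ.* i ℕ.+ suc j ℕ.+ 2)
  twice-sum = trans (ℕS.solve 3 (λ i j M →
      (con 1 :+ (i :+ (con 1 :+ j) :+ M)) :+ (i :+ (con 1 :+ j)) :+ ((con 1 :+ (i :+ (con 1 :+ j) :+ M)) :+ (i :+ (con 1 :+ j)))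
        := (i :+ con 3 :* j :+ con 2 :* M :+ con 3) :+ (con 3 :* i :+ (con 1 :+ j) :+ con 2)) refl i j M)
    (cong (ℕ._+ (3 ℕ.* i ℕ.+ suc j ℕ.+ 2)) (sym exponent))

-- the case j ≤ k, with k = i + j: binomial-identity for
-- α = C(k-1, j), β = C(k-1, j-1), γ = C(N, i), δ = C(N, i+1)
numerator-identity-≤ : ∀ i j M → NumeratorIdentity (i ℕ.+ j) M j
numerator-identity-≤ i j M = begin
  ℕ→ℚ N * ℕ→ℚ (binom k j ℕ.* binom (suc N) (suc k ∸ j))
    ≡⟨ cong (λ x → ℕ→ℚ N * ℕ→ℚ x) (cong₂ ℕ._*_ (binom-split j≤k) (cong (binom (suc N)) (ℕP.m+n∸n≡m (suc i) j))) ⟩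
  ℕ→ℚ N * ℕ→ℚ ((α ℕ.+ β) ℕ.* (γ ℕ.+ δ))
    ≡⟨ ℕ→ℚ-identity {N} {(α ℕ.+ β) ℕ.* (γ ℕ.+ δ)} {(α ℕ.+ β) ℕ.* δ ℕ.* M} {i ℕ.+ 3 ℕ.* j ℕ.+ 2 ℕ.* M ℕ.+ 2} {α ℕ.* γ} {3 ℕ.* i ℕ.+ j ℕ.+ 2} {β ℕ.* δ}
         (binomial-identity i j M α β γ δ absorption-δ absorption-α) ⟩
  ℕ→ℚ ((α ℕ.+ β) ℕ.* δ ℕ.* M) + ℕ→ℚ (i ℕ.+ 3 ℕ.* j ℕ.+ 2 ℕ.* M ℕ.+ 2) * ℕ→ℚ (α ℕ.* γ) + ℕ→ℚ (3 ℕ.* i ℕ.+ j ℕ.+ 2) * ℕ→ℚ (β ℕ.* δ)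
    ≡⟨ cong₂ _+_ (cong₂ _+_ (cong ℕ→ℚ upper-part) (cong₂ _*_ (cong ℕ→ℚ exponent) (cong ℕ→ℚ middle-part))) (lowerTerm-form i j M) ⟨
  ℕ→ℚ (binomPart N (suc k) j ℕ.* M) + ℕ→ℚ (xExponent N k j) * ℕ→ℚ (binomPart N k j) + lowerTerm N k j ∎
  where
  open ≡-Reasoning
  k = i ℕ.+ j
  N = suc (k ℕ.+ M)
  α = binom (k ∸ 1) j
  β = binomBelow k j
  γ = binom N i
  δ = binom N (suc i)
  j≤k : j ≤ k
  j≤k = ℕP.m≤n+m j i
  k∸j≡i : k ∸ j ≡ i
  k∸j≡i = ℕP.m+n∸n≡m i j
  absorption-δ : suc i ℕ.* δ ≡ suc (j ℕ.+ M) ℕ.* γ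
  absorption-δ = trans (absorption N i) (cong (ℕ._* γ) (trans (cong (_∸ i) (ℕS.solve 3 (λ i j M →
      con 1 :+ (i :+ j :+ M) := (con 1 :+ (j :+ M)) :+ i) refl i j M)) (ℕP.m+n∸n≡m (suc (j ℕ.+ M)) i)))
    where open ℕS
  absorption-α : j ℕ.* α ≡ i ℕ.* β
  absorption-α = trans (binom-ratio j≤k) (cong (ℕ._* β) k∸j≡i)
  upper-part : binomPart N (suc k) j ℕ.* M ≡ (α ℕ.+ β) ℕ.* δ ℕ.* M
  upper-part = cong (ℕ._* M) (cong₂ ℕ._*_ (binom-split j≤k) (cong (binom N) (ℕP.m+n∸n≡m (suc i) j)))
  middle-part : binomPart N k j ≡ α ℕ.* γ
  middle-part = cong (λ x → α ℕ.* binom N x) k∸j≡i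
  exponent : xExponent N k j ≡ i ℕ.+ 3 ℕ.* j ℕ.+ 2 ℕ.* M ℕ.+ 2
  exponent = trans (cong (_∸ k) (ℕS.solve 3 (λ i j M →
      (con 1 :+ (i :+ j :+ M)) :+ (con 1 :+ (i :+ j :+ M)) :+ (j :+ j)
        := (i :+ con 3 :* j :+ con 2 :* M :+ con 2) :+ (i :+ j)) refl i j M))
    (ℕP.m+n∸n≡m (i ℕ.+ 3 ℕ.* j ℕ.+ 2 ℕ.* M ℕ.+ 2) k)
    where open ℕS

vanishing-sum : ∀ n a b → n * 0ℚ ≡ 0ℚ + a * 0ℚ + b * 0ℚ
vanishing-sum = ℚS.solve 3 (λ n a b → n :* con 0ℚ := con 0ℚ :+ a :* con 0ℚ :+ b :* con 0ℚ) refl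
  where open ℚS

-- when j > k all binomial parts vanish (for k = 0, j = 1 the lower term has the
-- factor 2N - 2N = 0 instead)
numerator-identity-> : ∀ k M j → k < j → NumeratorIdentity k M j
numerator-identity-> zero M (suc zero) _ = begin
  ℕ→ℚ N * 0ℚ                                          ≡⟨ vanishing (ℕ→ℚ N) (ℕ→ℚ (xExponent N 0 1)) (ℕ→ℚ (binomPart N 0 0)) ⟩
  0ℚ + ℕ→ℚ (xExponent N 0 1) * 0ℚ + 0ℚ * ℕ→ℚ (binomPart N 0 0)
    ≡⟨ cong (λ c → 0ℚ + ℕ→ℚ (xExponent N 0 1) * 0ℚ + c * ℕ→ℚ (binomPart N 0 0)) (stepCoefficient-ℕ (xExponent N 0 0) (N ℕ.+ 0) 0 N+N≡2N) ⟨
  0ℚ + ℕ→ℚ (xExponent N 0 1) * 0ℚ + lowerTerm N 0 1   ∎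
  where
  open ≡-Reasoning
  N = suc (0 ℕ.+ M)
  N+N≡2N : N ℕ.+ 0 ℕ.+ (N ℕ.+ 0) ≡ N ℕ.+ N ℕ.+ 0 ℕ.+ 0
  N+N≡2N = ℕS.solve 1 (λ n → n :+ con 0 :+ (n :+ con 0) := n :+ n :+ con 0 :+ con 0) refl N
    where open ℕS
  vanishing : ∀ n a b → n * 0ℚ ≡ 0ℚ + a * 0ℚ + 0ℚ * b
  vanishing = ℚS.solve 3 (λ n a b → n :* con 0ℚ := con 0ℚ :+ a :* con 0ℚ :+ con 0ℚ :* b) refl
    where open ℚS
numerator-identity-> zero M (suc (suc j)) _ =
  vanishing-sum (ℕ→ℚ (suc M)) (ℕ→ℚ (xExponent (suc M) 0 (suc (suc j)))) (stepCoefficient (xExponent (suc M) 0 (suc j)) (suc M ℕ.+ 0))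
numerator-identity-> (suc k) M (suc j) (s≤s k<j)
  rewrite binom-above {suc k} {suc j} (s≤s k<j) | binom-above {k} {suc j} (ℕP.m<n⇒m<1+n k<j) | binom-above {k} {j} k<j
  = vanishing-sum (ℕ→ℚ N) (ℕ→ℚ (xExponent N (suc k) (suc j))) (stepCoefficient (xExponent N (suc k) j) (N ℕ.+ suc k))
  where N = suc (suc k ℕ.+ M)

numerator-identity : ∀ k M j → NumeratorIdentity k M j
numerator-identity k M j with j ℕP.≤? k
... | yes j≤k = subst (λ k → NumeratorIdentity k M j) (ℕP.m∸n+n≡m j≤k) (numerator-identity-≤ (k ∸ j) j M)
... | no j≰k = numerator-identity-> k M j (ℕP.≰⇒> j≰k)

weight-shift : ∀ Z N M → ℕ→ℚ (Z ℕ.* suc M) * recipℕ (N ℕ.* (suc M) !) ≡ ℕ→ℚ Z * recipℕ (N ℕ.* M !)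
weight-shift Z N M = begin
  ℕ→ℚ (Z ℕ.* suc M) * recipℕ (N ℕ.* (suc M) !)             ≡⟨ cong₂ _*_ (ℕ→ℚ-* Z (suc M)) (cong recipℕ (ℕS.solve 3 (λ n m f → n :* (f :+ m :* f) := (con 1 :+ m) :* (n :* f)) refl N M (M !))) ⟩
  ℕ→ℚ Z * ℕ→ℚ (suc M) * recipℕ (suc M ℕ.* (N ℕ.* M !))     ≡⟨ ℚP.*-assoc (ℕ→ℚ Z) (ℕ→ℚ (suc M)) _ ⟩
  ℕ→ℚ Z * (ℕ→ℚ (suc M) * recipℕ (suc M ℕ.* (N ℕ.* M !)))   ≡⟨ cong (ℕ→ℚ Z *_) (recipℕ-cancel M (N ℕ.* M !)) ⟩
  ℕ→ℚ Z * recipℕ (N ℕ.* M !)                               ∎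
  where open ≡-Reasoning
        open ℕS using (con; _:+_; _:*_; _:=_)

-- the main case of the recurrence, K = k + 1 ≤ n = k + M + 1: after clearing the
-- common factor 1/(n M!) it is the numerator identity
recurrence-main : ∀ k M j → Recurrence (suc (k ℕ.+ M)) (suc k) j
recurrence-main k M j = begin
  ℕ→ℚ (suc N) * coeff (suc N) (suc k) j
    ≡⟨ leading ⟩
  ℕ→ℚ N * ℕ→ℚ (binomPart (suc N) (suc k) j) * w
    ≡⟨ cong (_* w) (numerator-identity k M j) ⟩
  (ℕ→ℚ Y + ℕ→ℚ (xExponent N k j) * ℕ→ℚ (binomPart N k j) + lowerTerm N k j) * w
    ≡⟨ ℚS.solve 5 (λ y a z l w → (y :+ a :* z :+ l) :* w := y :* w :+ a :* (z :* w) :+ l :* w) refl (ℕ→ℚ Y) (ℕ→ℚ (xExponent N k j)) (ℕ→ℚ (binomPart N k j)) (lowerTerm N k j) w ⟩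
  ℕ→ℚ Y * w + ℕ→ℚ (xExponent N k j) * (ℕ→ℚ (binomPart N k j) * w) + lowerTerm N k j * w
    ≡⟨ cong₂ _+_ (cong₂ _+_ upper (cong (ℕ→ℚ (xExponent N k j) *_) (middle j))) (lower j) ⟨
  coeff N (suc k) j + coeffA N (suc k) j + coeffB N (suc k) j ∎
  where
  open ≡-Reasoning
  open ℚS using (con; _:+_; _:*_; _:=_)
  N = suc (k ℕ.+ M)
  Y = binomPart N (suc k) j ℕ.* M
  w = recipℕ (N ℕ.* M !)
  N∸k≡1+M : N ∸ k ≡ suc M
  N∸k≡1+M = trans (ℕP.+-∸-assoc 1 (ℕP.m≤m+n k M)) (cong suc (ℕP.m+n∸m≡n k M))
  leading : ℕ→ℚ (suc N) * coeff (suc N) (suc k) j ≡ ℕ→ℚ N * ℕ→ℚ (binomPart (suc N) (suc k) j) * w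
  leading = begin
    ℕ→ℚ (suc N) * (ℕ→ℚ (ν ℕ.* (N ∸ k)) * recipℕ (suc N ℕ.* (N ∸ k) !))
      ≡⟨ cong (λ t → ℕ→ℚ (suc N) * (ℕ→ℚ (ν ℕ.* t) * recipℕ (suc N ℕ.* t !))) N∸k≡1+M ⟩
    ℕ→ℚ (suc N) * (ℕ→ℚ (ν ℕ.* suc M) * recipℕ (suc N ℕ.* (suc M) !))
      ≡⟨ cong (ℕ→ℚ (suc N) *_) (weight-shift ν (suc N) M) ⟩
    ℕ→ℚ (suc N) * (ℕ→ℚ ν * recipℕ (suc N ℕ.* M !))
      ≡⟨ ℚS.solve 3 (λ a b c → a :* (b :* c) := b :* (a :* c)) refl (ℕ→ℚ (suc N)) (ℕ→ℚ ν) (recipℕ (suc N ℕ.* M !)) ⟩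
    ℕ→ℚ ν * (ℕ→ℚ (suc N) * recipℕ (suc N ℕ.* M !))
      ≡⟨ cong (ℕ→ℚ ν *_) (trans (recipℕ-cancel N (M !)) (sym (recipℕ-cancel (k ℕ.+ M) (M !)))) ⟩
    ℕ→ℚ ν * (ℕ→ℚ N * w)
      ≡⟨ ℚS.solve 3 (λ a b c → a :* (b :* c) := b :* a :* c) refl (ℕ→ℚ ν) (ℕ→ℚ N) w ⟩
    ℕ→ℚ N * ℕ→ℚ ν * w ∎
    where ν = binomPart (suc N) (suc k) j
  upper : coeff N (suc k) j ≡ ℕ→ℚ Y * w
  upper = cong (λ t → ℕ→ℚ (binomPart N (suc k) j ℕ.* t) * recipℕ (N ℕ.* t !)) (ℕP.m+n∸m≡n k M)
  middle : ∀ j → coeff N k j ≡ ℕ→ℚ (binomPart N k j) * w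
  middle j = trans (cong (λ t → ℕ→ℚ (binomPart N k j ℕ.* t) * recipℕ (N ℕ.* t !)) N∸k≡1+M) (weight-shift (binomPart N k j) N M)
  lower : ∀ j → coeffB N (suc k) j ≡ lowerTerm N k j * w
  lower zero = sym (ℚP.*-zeroˡ w)
  lower (suc j) = trans (cong (stepCoefficient (xExponent N k j) (N ℕ.+ k) *_) (middle j)) (sym (ℚP.*-assoc (stepCoefficient (xExponent N k j) (N ℕ.+ k)) (ℕ→ℚ (binomPart N k j)) w))

coeff-numerator-zero : ∀ n k j → binomPart (suc n) k j ℕ.* (suc n ∸ k) ≡ 0 → coeff (suc n) k j ≡ 0ℚ
coeff-numerator-zero n k j e = trans (cong (λ z → ℕ→ℚ z * recipℕ (suc n ℕ.* (suc n ∸ k) !)) e) (ℚP.*-zeroˡ (recipℕ (suc n ℕ.* (suc n ∸ k) !)))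

coeff-vanish : ∀ n k j → suc n ≤ k → coeff (suc n) k j ≡ 0ℚ
coeff-vanish n k j n<k = coeff-numerator-zero n k j
  (trans (cong (binomPart (suc n) k j ℕ.*_) (ℕP.m≤n⇒m∸n≡0 n<k)) (ℕP.*-zeroʳ (binomPart (suc n) k j)))

coeff-beyond-k : ∀ n k j → n < k → coeff n k j ≡ 0ℚ
coeff-beyond-k zero (suc k) j _ = refl
coeff-beyond-k (suc n) k j n<k = coeff-vanish n k j (ℕP.<⇒≤ n<k)

coeff-beyond-j : ∀ n k j → n < j → coeff n k j ≡ 0ℚ
coeff-beyond-j zero zero (suc j) _ = refl
coeff-beyond-j zero (suc k) (suc j) _ = refl
coeff-beyond-j (suc n) k j n<j with (k ∸ 1) ℕP.<? j
... | yes k-1<j = coeff-numerator-zero n k j (cong (λ z → z ℕ.* binom (suc n) (k ∸ j) ℕ.* (suc n ∸ k)) (binom-above k-1<j))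
... | no k-1≮j = coeff-vanish n k j (ℕP.≤-trans (ℕP.<⇒≤ n<j) (ℕP.≤-trans (ℕP.≮⇒≥ k-1≮j) (ℕP.m∸n≤m k 1)))

coeff-leading : ∀ m → coeff (suc m) 0 0 ≡ recipℕ ((suc m) !)
coeff-leading m = trans (cong (λ z → ℕ→ℚ z * recipℕ (suc m ℕ.* (suc m) !)) (ℕP.*-identityˡ (suc m))) (recipℕ-cancel m ((suc m) !))

recurrence-vanishing : ∀ n k j → coeff (suc n) (suc k) j ≡ 0ℚ → coeff n (suc k) j ≡ 0ℚ →
  coeff n k j ≡ 0ℚ → coeff n k (ℕ.pred j) ≡ 0ℚ → Recurrence n (suc k) j
recurrence-vanishing n k j e₀ e₁ e₂ e₃ = begin
  ℕ→ℚ (suc n) * coeff (suc n) (suc k) j    ≡⟨ cong (ℕ→ℚ (suc n) *_) e₀ ⟩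
  ℕ→ℚ (suc n) * 0ℚ                          ≡⟨ vanishing-sum (ℕ→ℚ (suc n)) (ℕ→ℚ (xExponent n k j)) (lowerFactor j) ⟩
  0ℚ + ℕ→ℚ (xExponent n k j) * 0ℚ + lowerFactor j * 0ℚ
    ≡⟨ cong₂ _+_ (cong₂ (λ u v → u + ℕ→ℚ (xExponent n k j) * v) e₁ e₂) (lower j e₃) ⟨
  coeff n (suc k) j + coeffA n (suc k) j + coeffB n (suc k) j ∎
  where
  open ≡-Reasoning
  lowerFactor : ℕ → ℚ
  lowerFactor zero = 0ℚ
  lowerFactor (suc j) = stepCoefficient (xExponent n k j) (n ℕ.+ k)
  lower : ∀ j → coeff n k (ℕ.pred j) ≡ 0ℚ → coeffB n (suc k) j ≡ lowerFactor j * 0ℚ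
  lower zero _ = refl
  lower (suc j) e = cong (lowerFactor (suc j) *_) e

coeff-recurrence : ∀ n K j → Recurrence n K j
coeff-recurrence zero zero zero = refl
coeff-recurrence zero zero (suc j) = refl
coeff-recurrence zero (suc zero) zero = refl
coeff-recurrence zero (suc zero) (suc zero) = refl
coeff-recurrence zero (suc zero) (suc (suc j)) = recurrence-vanishing 0 0 (suc (suc j)) (coeff-vanish 0 1 (suc (suc j)) ℕP.≤-refl) refl refl refl
coeff-recurrence zero (suc (suc k)) j = recurrence-vanishing 0 (suc k) j (coeff-vanish 0 (suc (suc k)) j (s≤s z≤n)) refl refl refl
coeff-recurrence (suc n) zero zero = begin
  ℕ→ℚ (2 ℕ.+ n) * coeff (2 ℕ.+ n) 0 0     ≡⟨ cong (ℕ→ℚ (2 ℕ.+ n) *_) (coeff-leading (suc n)) ⟩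
  ℕ→ℚ (2 ℕ.+ n) * recipℕ ((2 ℕ.+ n) !)    ≡⟨ recipℕ-cancel (suc n) ((suc n) !) ⟩
  recipℕ ((suc n) !)                       ≡⟨ coeff-leading n ⟨
  coeff (suc n) 0 0                        ≡⟨ ℚP.+-identityʳ (coeff (suc n) 0 0) ⟨
  coeff (suc n) 0 0 + 0ℚ                   ≡⟨ ℚP.+-identityʳ (coeff (suc n) 0 0 + 0ℚ) ⟨
  coeff (suc n) 0 0 + 0ℚ + 0ℚ              ∎
  where open ≡-Reasoning
coeff-recurrence (suc n) zero (suc j) = begin
  ℕ→ℚ (2 ℕ.+ n) * coeff (2 ℕ.+ n) 0 (suc j)   ≡⟨ cong (ℕ→ℚ (2 ℕ.+ n) *_) (coeff-numerator-zero (suc n) 0 (suc j) refl) ⟩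
  ℕ→ℚ (2 ℕ.+ n) * 0ℚ                           ≡⟨ ℚP.*-zeroʳ (ℕ→ℚ (2 ℕ.+ n)) ⟩
  0ℚ                                           ≡⟨ cong (λ z → z + 0ℚ + 0ℚ) (coeff-numerator-zero n 0 (suc j) refl) ⟨
  coeff (suc n) 0 (suc j) + 0ℚ + 0ℚ            ∎
  where open ≡-Reasoning
coeff-recurrence (suc n) (suc k) j with k ℕP.≤? n
... | yes k≤n = subst (λ N → Recurrence N (suc k) j) (cong suc (ℕP.m+[n∸m]≡n k≤n)) (recurrence-main k (n ∸ k) j)
... | no k≰n = recurrence-vanishing (suc n) k j
  (coeff-vanish (suc n) (suc k) j (s≤s n<k)) (coeff-vanish n (suc k) j (ℕP.m≤n⇒m≤1+n n<k))
  (coeff-vanish n k j n<k) (coeff-vanish n k (ℕ.pred j) n<k)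
  where
  n<k : suc n ≤ k
  n<k = ℕP.≰⇒> k≰n

cross-multiply : ∀ a b (X Y : ℚ) → ℕ→ℚ (suc a) * X ≡ ℕ→ℚ (suc b) * Y → X * recipℕ (suc b) ≡ Y * recipℕ (suc a)
cross-multiply a b X Y e = begin
  X * rb                       ≡⟨ ℚS.solve 4 (λ x rb ra na → x :* rb := (con 1ℚ :* x) :* rb) refl X rb ra na ⟩
  (1ℚ * X) * rb                ≡⟨ cong (λ z → (z * X) * rb) (sym (recipℕ-inverse a)) ⟩
  ((ra * na) * X) * rb         ≡⟨ ℚS.solve 4 (λ x rb ra na → ((ra :* na) :* x) :* rb := ra :* (na :* x) :* rb) refl X rb ra na ⟩
  ra * (na * X) * rb           ≡⟨ cong (λ z → ra * z * rb) e ⟩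
  ra * (nb * Y) * rb           ≡⟨ ℚS.solve 4 (λ y rb ra nb → ra :* (nb :* y) :* rb := y :* ra :* (rb :* nb)) refl Y rb ra nb ⟩
  Y * ra * (rb * nb)           ≡⟨ cong (Y * ra *_) (recipℕ-inverse b) ⟩
  Y * ra * 1ℚ                  ≡⟨ ℚP.*-identityʳ (Y * ra) ⟩
  Y * ra                       ∎
  where
  open ≡-Reasoning
  open ℚS using (con; _:*_; _:=_)
  ra = recipℕ (suc a)
  rb = recipℕ (suc b)
  na = ℕ→ℚ (suc a)
  nb = ℕ→ℚ (suc b)

-- (i+1) C(i, j) C(m+1, p+1) = (m+1) C(i+1, j) C(m, p) for p = i - j, from
-- (i+1) C(i, j) = (p+1) C(i+1, j)  and  (p+1) C(m+1, p+1) = (m+1) C(m, p)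
binomial-cross : ∀ m i j → j ≤ i → suc i ℕ.* (binom i j ℕ.* binom (suc m) (suc (i ∸ j))) ≡ suc m ℕ.* (binom (suc i) j ℕ.* binom m (i ∸ j))
binomial-cross m i j j≤i = begin
  suc i ℕ.* (binom i j ℕ.* binom (suc m) (suc p))          ≡⟨ ℕP.*-assoc (suc i) (binom i j) (binom (suc m) (suc p)) ⟨
  suc i ℕ.* binom i j ℕ.* binom (suc m) (suc p)            ≡⟨ cong (ℕ._* binom (suc m) (suc p)) lower-absorption ⟩
  suc p ℕ.* binom (suc i) j ℕ.* binom (suc m) (suc p)      ≡⟨ ℕS.solve 3 (λ a b c → a :* b :* c := b :* (a :* c)) refl (suc p) (binom (suc i) j) (binom (suc m) (suc p)) ⟩
  binom (suc i) j ℕ.* (suc p ℕ.* binom (suc m) (suc p))    ≡⟨ cong (binom (suc i) j ℕ.*_) (absorption-suc m p) ⟩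
  binom (suc i) j ℕ.* (suc m ℕ.* binom m p)                ≡⟨ ℕS.solve 3 (λ a b c → a :* (b :* c) := b :* (a :* c)) refl (binom (suc i) j) (suc m) (binom m p) ⟩
  suc m ℕ.* (binom (suc i) j ℕ.* binom m p)                ∎
  where
  open ≡-Reasoning
  open ℕS using (_:*_; _:=_)
  p = i ∸ j
  lower-absorption : suc i ℕ.* binom i j ≡ suc p ℕ.* binom (suc i) j
  lower-absorption = trans (sym (absorption-suc i j)) (trans (absorption (suc i) j) (cong (ℕ._* binom (suc i) j) (ℕP.+-∸-assoc 1 j≤i)))

coeff-closed-form : ∀ m i j → suc i ≤ m → j ≤ i →
  coeff (suc m) (suc i) j ≡ recipℕ (suc i ℕ.* (suc (suc m) ∸ suc i ∸ 2) !) * ℕ→ℚ ((suc i C j) ℕ.* (m C (suc i ∸ j ∸ 1)))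
coeff-closed-form m i j i<m j≤i = begin
  ℕ→ℚ (binom i j ℕ.* binom (suc m) (suc i ∸ j) ℕ.* (m ∸ i)) * recipℕ (suc m ℕ.* (m ∸ i) !)
    ≡⟨ cong₂ (λ u t → ℕ→ℚ (binom i j ℕ.* binom (suc m) u ℕ.* t) * recipℕ (suc m ℕ.* t !)) 1+i∸j≡1+p m∸i≡1+q ⟩
  ℕ→ℚ (X ℕ.* suc q) * recipℕ (suc m ℕ.* (suc q) !)
    ≡⟨ weight-shift X (suc m) q ⟩
  ℕ→ℚ X * recipℕ (suc m ℕ.* q !)
    ≡⟨ trans (cong (ℕ→ℚ X *_) (recipℕ-* (suc m) (q !))) (sym (ℚP.*-assoc (ℕ→ℚ X) (recipℕ (suc m)) (recipℕ (q !)))) ⟩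
  ℕ→ℚ X * recipℕ (suc m) * recipℕ (q !)
    ≡⟨ cong (_* recipℕ (q !)) (cross-multiply i m (ℕ→ℚ X) (ℕ→ℚ Y) (trans (sym (ℕ→ℚ-* (suc i) X)) (trans (cong ℕ→ℚ (binomial-cross m i j j≤i)) (ℕ→ℚ-* (suc m) Y)))) ⟩
  ℕ→ℚ Y * recipℕ (suc i) * recipℕ (q !)
    ≡⟨ ℚS.solve 3 (λ y a b → y :* a :* b := a :* b :* y) refl (ℕ→ℚ Y) (recipℕ (suc i)) (recipℕ (q !)) ⟩
  recipℕ (suc i) * recipℕ (q !) * ℕ→ℚ Y
    ≡⟨ cong (_* ℕ→ℚ Y) (recipℕ-* (suc i) (q !)) ⟨
  recipℕ (suc i ℕ.* q !) * ℕ→ℚ Y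
    ≡⟨ cong₂ (λ t y → recipℕ (suc i ℕ.* t !) * ℕ→ℚ y) (sym q-form) (sym paper-binomials) ⟩
  recipℕ (suc i ℕ.* (suc (suc m) ∸ suc i ∸ 2) !) * ℕ→ℚ ((suc i C j) ℕ.* (m C (suc i ∸ j ∸ 1))) ∎
  where
  open ≡-Reasoning
  open ℚS using (_:*_; _:=_)
  p = i ∸ j
  q = m ∸ suc i
  X = binom i j ℕ.* binom (suc m) (suc p)
  Y = binom (suc i) j ℕ.* binom m p
  1+i∸j≡1+p : suc i ∸ j ≡ suc p
  1+i∸j≡1+p = ℕP.+-∸-assoc 1 j≤i
  m∸i≡1+q : m ∸ i ≡ suc q
  m∸i≡1+q = ℕP.+-∸-assoc 1 i<m
  q-form : suc (suc m) ∸ suc i ∸ 2 ≡ q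
  q-form = cong (_∸ 2) (trans (ℕP.+-∸-assoc 1 (ℕP.<⇒≤ i<m)) (cong suc m∸i≡1+q))
  paper-binomials : (suc i C j) ℕ.* (m C (suc i ∸ j ∸ 1)) ≡ Y
  paper-binomials = cong₂ ℕ._*_ (C≡binom (suc i) j) (trans (cong (m C_) (cong (_∸ 1) 1+i∸j≡1+p)) (C≡binom m p))

module _ {n k} (j : ℕ) (k≤n : k ≤ n) where
  private
    L = n ℕ.+ n ℕ.+ (j ℕ.+ j)
    k≤L : k ≤ L
    k≤L = ℕP.≤-trans k≤n (ℕP.≤-trans (ℕP.m≤m+n n n) (ℕP.m≤m+n (n ℕ.+ n) (j ℕ.+ j)))
    open ℕS using (con; _:+_; _:=_)

  xExponent-next : suc (xExponent n k j) ≡ xExponent (suc n) (suc k) j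
  xExponent-next = sym (trans (cong (_∸ suc k) (ℕS.solve 2 (λ n j → (con 1 :+ n) :+ (con 1 :+ n) :+ (j :+ j) := con 2 :+ (n :+ n :+ (j :+ j))) refl n j))
    (ℕP.+-∸-assoc 1 k≤L))

  xExponent-next-j : 3 ℕ.+ xExponent n k j ≡ xExponent (suc n) (suc k) (suc j)
  xExponent-next-j = sym (trans (cong (_∸ suc k) (ℕS.solve 2 (λ n j → (con 1 :+ n) :+ (con 1 :+ n) :+ ((con 1 :+ j) :+ (con 1 :+ j)) := con 4 :+ (n :+ n :+ (j :+ j))) refl n j))
    (ℕP.+-∸-assoc 3 k≤L))

  xExponent-same : 2 ℕ.+ xExponent n k j ≡ xExponent (suc n) k j
  xExponent-same = sym (trans (cong (_∸ k) (ℕS.solve 2 (λ n j → (con 1 :+ n) :+ (con 1 :+ n) :+ (j :+ j) := con 2 :+ (n :+ n :+ (j :+ j))) refl n j))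
    (ℕP.+-∸-assoc 2 k≤L))

-- the statement writes the exponent of x as 2r - k + 2j - 2, with r = n + 1
xExponent-paper : ∀ m k j → (2 ℕ.* suc (suc m) ℕ.+ 2 ℕ.* j) ∸ (k ℕ.+ 2) ≡ xExponent (suc m) k j
xExponent-paper m k j = trans
  (cong₂ _∸_ (ℕS.solve 2 (λ m j → con 2 :* (con 2 :+ m) :+ con 2 :* j := con 2 :+ ((con 1 :+ m) :+ (con 1 :+ m) :+ (j :+ j))) refl m j) (ℕP.+-comm k 2))
  (ℕP.[m+n]∸[m+o]≡n∸o 2 (suc m ℕ.+ suc m ℕ.+ (j ℕ.+ j)) k)
  where open ℕS using (con; _:+_; _:*_; _:=_)

term : ℕ → ℕ → ℕ → Series
term n k j = constₛ (coeff n k j) *ₛ monomial (xExponent n k j) (n ℕ.+ k) (derivⁿ (n ∸ k) f)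

normalForm : ℕ → Series
normalForm n = Σₛ (suc n) (λ k → Σₛ (suc n) (term n k))

nextMonomial : ℕ → ℕ → ℕ → Series
nextMonomial n K j = monomial (xExponent (suc n) K j) (suc n ℕ.+ K) (derivⁿ (suc n ∸ K) f)

U-deriv-term : ∀ n k j → k ≤ n → U *ₛ deriv (term n k j) ≈ₛ
  constₛ (coeffA n (suc k) j) *ₛ nextMonomial n (suc k) j
    +ₛ constₛ (coeffB n (suc k) (suc j)) *ₛ nextMonomial n (suc k) (suc j)
    +ₛ constₛ (coeff n k j) *ₛ nextMonomial n k j
U-deriv-term n k j k≤n = begin
  U *ₛ deriv (c *ₛ Y)
    ≈⟨ *ₛ-congˡ U (≈ₛ-trans (deriv-leibniz c Y) (+ₛ-congʳ (c *ₛ deriv Y) (*ₛ-congʳ Y (deriv-const (coeff n k j))))) ⟩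
  U *ₛ (constₛ 0ℚ *ₛ Y +ₛ c *ₛ deriv Y)
    ≈⟨ solve 4 (λ u c y d → u :* (con 0ℚ :* y :+ c :* d) := c :* (u :* d)) ≈ₛ-refl U c Y (deriv Y) ⟩
  c *ₛ (U *ₛ deriv Y)
    ≈⟨ *ₛ-congˡ c (U-deriv-monomial a b G) ⟩
  c *ₛ (constₛ (ℕ→ℚ a) *ₛ monomial (suc a) (2 ℕ.+ b) G +ₛ constₛ (stepCoefficient a b) *ₛ monomial (3 ℕ.+ a) (2 ℕ.+ b) G +ₛ monomial (2 ℕ.+ a) (suc b) (deriv G))
    ≈⟨ *ₛ-congˡ c (≡⇒≈ₛ (cong₂ _+ₛ_ (cong₂ _+ₛ_ (cong (constₛ (ℕ→ℚ a) *ₛ_) (cong₂ (λ x y → monomial x y G) (xExponent-next j k≤n) shift-P))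
                                                (cong (constₛ (stepCoefficient a b) *ₛ_) (cong₂ (λ x y → monomial x y G) (xExponent-next-j j k≤n) shift-P)))
                                   (cong₂ (λ x G → monomial x (suc b) G) (xExponent-same j k≤n) (cong (λ d → derivⁿ d f) shift-f)))) ⟩
  c *ₛ (constₛ (ℕ→ℚ a) *ₛ Z₁ +ₛ constₛ (stepCoefficient a b) *ₛ Z₃ +ₛ Z₂)
    ≈⟨ solve 6 (λ c cA cB z₁ z₃ z₂ → c :* (cA :* z₁ :+ cB :* z₃ :+ z₂) := (cA :* c) :* z₁ :+ (cB :* c) :* z₃ :+ c :* z₂) ≈ₛ-refl c (constₛ (ℕ→ℚ a)) (constₛ (stepCoefficient a b)) Z₁ Z₃ Z₂ ⟩
  (constₛ (ℕ→ℚ a) *ₛ c) *ₛ Z₁ +ₛ (constₛ (stepCoefficient a b) *ₛ c) *ₛ Z₃ +ₛ c *ₛ Z₂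
    ≈⟨ +ₛ-congʳ (c *ₛ Z₂) (+ₛ-cong (*ₛ-congʳ Z₁ (constₛ-* (ℕ→ℚ a) (coeff n k j))) (*ₛ-congʳ Z₃ (constₛ-* (stepCoefficient a b) (coeff n k j)))) ⟨
  constₛ (coeffA n (suc k) j) *ₛ Z₁ +ₛ constₛ (coeffB n (suc k) (suc j)) *ₛ Z₃ +ₛ c *ₛ Z₂ ∎
  where
  open SeriesReasoning
  a = xExponent n k j
  b = n ℕ.+ k
  G = derivⁿ (n ∸ k) f
  c = constₛ (coeff n k j)
  Y = monomial a b G
  Z₁ = nextMonomial n (suc k) j
  Z₂ = nextMonomial n k j
  Z₃ = nextMonomial n (suc k) (suc j)
  shift-P : 2 ℕ.+ b ≡ suc n ℕ.+ suc k
  shift-P = cong suc (sym (ℕP.+-suc n k))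
  shift-f : suc (n ∸ k) ≡ suc n ∸ k
  shift-f = sym (ℕP.+-∸-assoc 1 k≤n)

vanishing-term : ∀ {q} G → q ≡ 0ℚ → constₛ q *ₛ G ≈ₛ zeroₛ
vanishing-term G refl = ≈ₛ-trans (*ₛ-congʳ G constₛ-0) (*ₛ-zeroˡ G)

module NormalFormStep (n : ℕ) where
  private
    N = suc n
    ΣΣ : ℕ → (ℕ → ℕ → Series) → Series
    ΣΣ M g = Σₛ M (λ k → Σₛ M (g k))

    ΣΣ-split : ∀ M (g h l : ℕ → ℕ → Series) → ΣΣ M (λ k j → g k j +ₛ h k j +ₛ l k j) ≈ₛ ΣΣ M g +ₛ ΣΣ M h +ₛ ΣΣ M l
    ΣΣ-split M g h l = ≈ₛ-trans
      (Σₛ-cong M (λ k _ → ≈ₛ-trans (Σₛ-+ M (λ j → g k j +ₛ h k j) (l k)) (+ₛ-congʳ (Σₛ M (l k)) (Σₛ-+ M (g k) (h k)))))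
      (≈ₛ-trans (Σₛ-+ M (λ k → Σₛ M (g k) +ₛ Σₛ M (h k)) (λ k → Σₛ M (l k))) (+ₛ-congʳ (ΣΣ M l) (Σₛ-+ M (λ k → Σₛ M (g k)) (λ k → Σₛ M (h k)))))

    shiftedA shiftedB unshifted : ℕ → ℕ → Series
    shiftedA k j = constₛ (coeffA n (suc k) j) *ₛ nextMonomial n (suc k) j
    shiftedB k j = constₛ (coeffB n (suc k) (suc j)) *ₛ nextMonomial n (suc k) (suc j)
    unshifted k j = constₛ (coeff n k j) *ₛ nextMonomial n k j

    partA partB partC : ℕ → ℕ → Series
    partA K j = constₛ (coeffA n K j) *ₛ nextMonomial n K j
    partB K j = constₛ (coeffB n K j) *ₛ nextMonomial n K j
    partC K j = constₛ (coeff n K j) *ₛ nextMonomial n K j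

    images : U *ₛ deriv (normalForm n) ≈ₛ ΣΣ N shiftedA +ₛ ΣΣ N shiftedB +ₛ ΣΣ N unshifted
    images = ≈ₛ-trans (*ₛ-congˡ U (≈ₛ-trans (deriv-Σₛ N (λ k → Σₛ N (term n k))) (Σₛ-cong N (λ k _ → deriv-Σₛ N (term n k)))))
      (≈ₛ-trans (*ₛ-Σₛ N U (λ k → Σₛ N (λ j → deriv (term n k j))))
      (≈ₛ-trans (Σₛ-cong N (λ k k<N → ≈ₛ-trans (*ₛ-Σₛ N U (λ j → deriv (term n k j))) (Σₛ-cong N (λ j _ → U-deriv-term n k j (ℕP.≤-pred k<N)))))
        (ΣΣ-split N shiftedA shiftedB unshifted)))

    recurrence : ∀ K j → constₛ (ℕ→ℚ N) *ₛ term N K j ≈ₛ partC K j +ₛ partA K j +ₛ partB K j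
    recurrence K j = begin
      constₛ (ℕ→ℚ N) *ₛ (constₛ (coeff N K j) *ₛ Z)
        ≈⟨ solve 3 (λ a c z → a :* (c :* z) := (a :* c) :* z) ≈ₛ-refl (constₛ (ℕ→ℚ N)) (constₛ (coeff N K j)) Z ⟩
      (constₛ (ℕ→ℚ N) *ₛ constₛ (coeff N K j)) *ₛ Z
        ≈⟨ *ₛ-congʳ Z (≈ₛ-trans (≈ₛ-sym (constₛ-* (ℕ→ℚ N) (coeff N K j))) (≡⇒≈ₛ (cong constₛ (coeff-recurrence n K j)))) ⟩
      constₛ (coeff n K j + coeffA n K j + coeffB n K j) *ₛ Z
        ≈⟨ *ₛ-congʳ Z (≈ₛ-trans (constₛ-+ (coeff n K j + coeffA n K j) (coeffB n K j)) (+ₛ-congʳ (constₛ (coeffB n K j)) (constₛ-+ (coeff n K j) (coeffA n K j)))) ⟩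
      (constₛ (coeff n K j) +ₛ constₛ (coeffA n K j) +ₛ constₛ (coeffB n K j)) *ₛ Z
        ≈⟨ solve 4 (λ a b c z → (a :+ b :+ c) :* z := a :* z :+ b :* z :+ c :* z) ≈ₛ-refl (constₛ (coeff n K j)) (constₛ (coeffA n K j)) (constₛ (coeffB n K j)) Z ⟩
      partC K j +ₛ partA K j +ₛ partB K j ∎
      where
      open SeriesReasoning
      Z = nextMonomial n K j

    parts : constₛ (ℕ→ℚ N) *ₛ normalForm N ≈ₛ ΣΣ (suc N) partC +ₛ ΣΣ (suc N) partA +ₛ ΣΣ (suc N) partB
    parts = ≈ₛ-trans (*ₛ-Σₛ (suc N) (constₛ (ℕ→ℚ N)) (λ K → Σₛ (suc N) (term N K)))
      (≈ₛ-trans (Σₛ-cong (suc N) (λ K _ → ≈ₛ-trans (*ₛ-Σₛ (suc N) (constₛ (ℕ→ℚ N)) (term N K)) (Σₛ-cong (suc N) (λ j _ → recurrence K j))))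
        (ΣΣ-split (suc N) partC partA partB))

    -- reindexing: the parts of the recurrence are the families of images
    partA≈ : ΣΣ (suc N) partA ≈ₛ ΣΣ N shiftedA
    partA≈ = ≈ₛ-trans (Σₛ-dropFirst N (λ K → Σₛ (suc N) (partA K)) (Σₛ-zero (suc N) (partA 0) (λ j → vanishing-term (nextMonomial n 0 j) refl)))
      (Σₛ-cong N (λ k _ → Σₛ-dropLast N (partA (suc k)) (vanishing-term (nextMonomial n (suc k) N)
        (trans (cong (ℕ→ℚ (xExponent n k N) *_) (coeff-beyond-j n k N (ℕP.n<1+n n))) (ℚP.*-zeroʳ (ℕ→ℚ (xExponent n k N)))))))

    partB≈ : ΣΣ (suc N) partB ≈ₛ ΣΣ N shiftedB
    partB≈ = ≈ₛ-trans (Σₛ-dropFirst N (λ K → Σₛ (suc N) (partB K)) (Σₛ-zero (suc N) (partB 0) (λ j → vanishing-term (nextMonomial n 0 j) refl)))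
      (Σₛ-cong N (λ k _ → Σₛ-dropFirst N (partB (suc k)) (vanishing-term (nextMonomial n (suc k) 0) refl)))

    partC≈ : ΣΣ (suc N) partC ≈ₛ ΣΣ N unshifted
    partC≈ = ≈ₛ-trans (Σₛ-dropLast N (λ K → Σₛ (suc N) (partC K)) (Σₛ-zero (suc N) (partC N) (λ j → vanishing-term (nextMonomial n N j) (coeff-beyond-k n N j (ℕP.n<1+n n)))))
      (Σₛ-cong N (λ k _ → Σₛ-dropLast N (partC k) (vanishing-term (nextMonomial n k N) (coeff-beyond-j n k N (ℕP.n<1+n n)))))

  normalForm-step : U *ₛ deriv (normalForm n) ≈ₛ constₛ (ℕ→ℚ (suc n)) *ₛ normalForm (suc n)
  normalForm-step = ≈ₛ-trans images (≈ₛ-sym (≈ₛ-trans parts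
    (≈ₛ-trans (+ₛ-cong (+ₛ-cong partC≈ partA≈) partB≈)
      (solve 3 (λ c a b → c :+ a :+ b := a :+ b :+ c) ≈ₛ-refl (ΣΣ N unshifted) (ΣΣ N shiftedA) (ΣΣ N shiftedB)))))
    where open SeriesReasoning

open NormalFormStep using (normalForm-step)

power-normalForm : ∀ n → f ^ₛ suc n ≈ₛ normalForm n
power-normalForm zero = begin
  f *ₛ oneₛ                                                  ≈⟨ *ₛ-identityʳ f ⟩
  f                                                          ≈⟨ solve 1 (λ g → g := con 1ℚ :* (con 1ℚ :* (con 1ℚ :* g)) :+ con 0ℚ :+ con 0ℚ) ≈ₛ-refl f ⟩
  constₛ 1ℚ *ₛ (constₛ 1ℚ *ₛ (constₛ 1ℚ *ₛ f)) +ₛ constₛ 0ℚ +ₛ constₛ 0ℚ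
    ≈⟨ +ₛ-cong (+ₛ-cong (*ₛ-congˡ (constₛ 1ℚ) (*ₛ-cong constₛ-1 (*ₛ-congʳ f constₛ-1))) constₛ-0) constₛ-0 ⟩
  normalForm 0                                               ∎
  where open SeriesReasoning
power-normalForm (suc n) = begin
  f ^ₛ suc (suc n)                                            ≈⟨ power-step n ⟩
  r *ₛ (U *ₛ deriv (f ^ₛ suc n))                              ≈⟨ *ₛ-congˡ r (*ₛ-congˡ U (deriv-cong (power-normalForm n))) ⟩
  r *ₛ (U *ₛ deriv (normalForm n))                            ≈⟨ *ₛ-congˡ r (normalForm-step n) ⟩
  r *ₛ (constₛ (ℕ→ℚ (suc n)) *ₛ normalForm (suc n))           ≈⟨ solve 3 (λ r c t → r :* (c :* t) := (r :* c) :* t) ≈ₛ-refl r (constₛ (ℕ→ℚ (suc n))) (normalForm (suc n)) ⟩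
  (r *ₛ constₛ (ℕ→ℚ (suc n))) *ₛ normalForm (suc n)           ≈⟨ *ₛ-congʳ (normalForm (suc n)) (≈ₛ-trans (≈ₛ-sym (constₛ-* (recipℕ (suc n)) (ℕ→ℚ (suc n)))) (≡⇒≈ₛ (cong constₛ (recipℕ-inverse n)))) ⟩
  constₛ 1ℚ *ₛ normalForm (suc n)                             ≈⟨ solve 1 (λ t → con 1ℚ :* t := t) ≈ₛ-refl (normalForm (suc n)) ⟩
  normalForm (suc n)                                          ∎
  where
  open SeriesReasoning
  r = constₛ (recipℕ (suc n))

xpow-≢ : ∀ k n → ¬ k ≡ n → xpow k n ≡ 0ℚ
xpow-≢ k n k≢n with k ℕ.≟ n
... | yes k≡n = ⊥-elim (k≢n k≡n)
... | no _ = refl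

xpow-diag : ∀ k → xpow k k ≡ 1ℚ
xpow-diag k with k ℕ.≟ k
... | yes _ = refl
... | no k≢k = ⊥-elim (k≢k refl)

xpow-suc : ∀ k n → xpow (suc k) (suc n) ≡ xpow k n
xpow-suc k n = by-cases (k ℕ.≟ n)
  where
  by-cases : Dec (k ≡ n) → xpow (suc k) (suc n) ≡ xpow k n
  by-cases (yes refl) = trans (xpow-diag (suc k)) (sym (xpow-diag k))
  by-cases (no k≢n) = trans (xpow-≢ (suc k) (suc n) (λ e → k≢n (ℕP.suc-injective e))) (sym (xpow-≢ k n k≢n))

xpow≈Xₛ^ : ∀ k → xpow k ≈ₛ Xₛ ^ₛ k
xpow≈Xₛ^ zero zero = refl
xpow≈Xₛ^ zero (suc n) = refl
xpow≈Xₛ^ (suc k) zero = sym (Xₛ-*ₛ-zero (Xₛ ^ₛ k))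
xpow≈Xₛ^ (suc k) (suc n) = trans (xpow-suc k n) (trans (xpow≈Xₛ^ k n) (sym (Xₛ-*ₛ-suc (Xₛ ^ₛ k) n)))

-- For r = m + 2, the normal form of f^{m+2} is the right-hand side of the statement:
-- its k = 0 row is the first term, its rows k = 1, …, m are the k-th terms, and
-- its row k = m + 1 vanishes.
module MatchStatement (m : ℕ) where
  private
    n r : ℕ
    n = suc m
    r = suc n

  first-row : Σₛ (suc n) (term n 0) ≈ₛ firstTerm r
  first-row = begin
    term n 0 0 +ₛ Σₛ n (λ j → term n 0 (suc j))
      ≈⟨ +ₛ-congˡ (term n 0 0) (Σₛ-zero n (λ j → term n 0 (suc j)) (λ j → vanishing-term (monomial (xExponent n 0 (suc j)) (n ℕ.+ 0) (derivⁿ n f)) (coeff-numerator-zero m 0 (suc j) refl))) ⟩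
    term n 0 0 +ₛ zeroₛ
      ≈⟨ (λ i → ℚP.+-identityʳ (term n 0 0 i)) ⟩
    constₛ (coeff n 0 0) *ₛ (Xₛ ^ₛ xExponent n 0 0 *ₛ (P ^ₛ (n ℕ.+ 0) *ₛ derivⁿ n f))
      ≈⟨ *ₛ-cong (≡⇒≈ₛ (cong constₛ (coeff-leading m))) (≡⇒≈ₛ (cong₂ (λ a b → Xₛ ^ₛ a *ₛ (P ^ₛ b *ₛ derivⁿ n f)) (sym exponent) (ℕP.+-identityʳ n))) ⟩
    constₛ (recipℕ (n !)) *ₛ (Xₛ ^ₛ (2 ℕ.* r ∸ 2) *ₛ (P ^ₛ n *ₛ derivⁿ n f))
      ≈⟨ *ₛ-congˡ (constₛ (recipℕ (n !))) (*ₛ-cong (≈ₛ-sym (xpow≈Xₛ^ (2 ℕ.* r ∸ 2))) (*ₛ-comm (P ^ₛ n) (derivⁿ n f))) ⟩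
    constₛ (recipℕ (n !)) *ₛ (xpow (2 ℕ.* r ∸ 2) *ₛ (derivⁿ n f *ₛ P ^ₛ n))
      ≈⟨ constₛ-*ₛ (recipℕ (n !)) (xpow (2 ℕ.* r ∸ 2) *ₛ (derivⁿ n f *ₛ P ^ₛ n)) ⟩
    firstTerm r ∎
    where
    open SeriesReasoning
    exponent : 2 ℕ.* r ∸ 2 ≡ xExponent n 0 0
    exponent = trans (cong (_∸ 2) (sym (ℕP.+-identityʳ (2 ℕ.* r)))) (xExponent-paper m 0 0)

  -- the row k = i + 1 (1 ≤ k ≤ m) has the terms j < k, which are those of the k-th term
  row : ∀ i → i < m → Σₛ (suc n) (term n (suc i)) ≈ₛ kthTerm r (suc i)
  row i i<m = begin
    Σₛ (suc n) (term n k)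
      ≈⟨ ≡⇒≈ₛ (cong (λ x → Σₛ x (term n k)) (sym (ℕP.m+[n∸m]≡n k≤n+1))) ⟩
    Σₛ (k ℕ.+ (suc n ∸ k)) (term n k)
      ≈⟨ Σₛ-truncate k (suc n ∸ k) (term n k) (λ j k≤j → vanishing-term (monomial (xExponent n k j) (n ℕ.+ k) (derivⁿ (n ∸ k) f))
           (coeff-numerator-zero m k j (cong (λ z → z ℕ.* binom n (k ∸ j) ℕ.* (n ∸ k)) (binom-above k≤j)))) ⟩
    Σₛ k (term n k)
      ≈⟨ Σₛ-cong k (λ j j<k → paper-term j (ℕP.≤-pred j<k)) ⟩
    Σₛ k (λ j → constₛ R *ₛ (cj j ·ₛ xpow (ej j) *ₛ W))
      ≈⟨ ≈ₛ-sym (*ₛ-Σₛ k (constₛ R) (λ j → cj j ·ₛ xpow (ej j) *ₛ W)) ⟩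
    constₛ R *ₛ Σₛ k (λ j → cj j ·ₛ xpow (ej j) *ₛ W)
      ≈⟨ *ₛ-congˡ (constₛ R) (≈ₛ-sym (≈ₛ-trans (*ₛ-congʳ W (sumₛ-applyUpTo (λ j → cj j ·ₛ xpow (ej j)) (λ x → x) k)) (Σₛ-*ₛ k (λ j → cj j ·ₛ xpow (ej j)) W))) ⟩
    constₛ R *ₛ (numer r k *ₛ W)
      ≈⟨ constₛ-*ₛ R (numer r k *ₛ W) ⟩
    kthTerm r k ∎
    where
    open SeriesReasoning
    k = suc i
    k≤n+1 : k ≤ suc n
    k≤n+1 = ℕP.m≤n⇒m≤1+n (ℕP.m≤n⇒m≤1+n i<m)
    R = recipℕ (k ℕ.* (r ∸ k ∸ 2) !)
    cj : ℕ → ℚ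
    cj j = ℕ→ℚ ((k C j) ℕ.* ((r ∸ 2) C (k ∸ j ∸ 1)))
    ej : ℕ → ℕ
    ej j = (2 ℕ.* r ℕ.+ 2 ℕ.* j) ∸ (k ℕ.+ 2)
    W = invOneMinusX² ^ₛ (r ℕ.+ k ∸ 1) *ₛ derivⁿ (r ∸ k ∸ 1) f
    derivative-order : r ∸ k ∸ 1 ≡ n ∸ k
    derivative-order = cong (_∸ 1) (ℕP.+-∸-assoc 1 (ℕP.<⇒≤ i<m))
    paper-term : ∀ j → j ≤ i → term n k j ≈ₛ constₛ R *ₛ (cj j ·ₛ xpow (ej j) *ₛ W)
    paper-term j j≤i = ≈ₛ-sym (begin
      constₛ R *ₛ (cj j ·ₛ xpow (ej j) *ₛ W)
        ≈⟨ *ₛ-congˡ (constₛ R) (*ₛ-congʳ W (≈ₛ-trans (≈ₛ-sym (constₛ-*ₛ (cj j) (xpow (ej j)))) (*ₛ-congˡ (constₛ (cj j)) (xpow≈Xₛ^ (ej j))))) ⟩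
      constₛ R *ₛ (constₛ (cj j) *ₛ Xₛ ^ₛ ej j *ₛ W)
        ≈⟨ solve 4 (λ a b x w → a :* (b :* x :* w) := (a :* b) :* (x :* w)) ≈ₛ-refl (constₛ R) (constₛ (cj j)) (Xₛ ^ₛ ej j) W ⟩
      (constₛ R *ₛ constₛ (cj j)) *ₛ (Xₛ ^ₛ ej j *ₛ W)
        ≈⟨ *ₛ-cong (≈ₛ-trans (≈ₛ-sym (constₛ-* R (cj j))) (≡⇒≈ₛ (cong constₛ (sym (coeff-closed-form m i j i<m j≤i)))))
                   (≡⇒≈ₛ (cong₂ (λ a b → Xₛ ^ₛ a *ₛ (P ^ₛ (n ℕ.+ k) *ₛ derivⁿ b f)) (xExponent-paper m k j) derivative-order)) ⟩
      term n k j ∎)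

  last-row : Σₛ (suc n) (term n n) ≈ₛ zeroₛ
  last-row = Σₛ-zero (suc n) (term n n) (λ j → vanishing-term (monomial (xExponent n n j) (n ℕ.+ n) (derivⁿ (n ∸ n) f)) (coeff-vanish m n j ℕP.≤-refl))

  normalForm≈rhs : normalForm n ≈ₛ rhs r
  normalForm≈rhs = begin
    normalForm n
      ≈⟨ Σₛ-dropLast n (λ k → Σₛ (suc n) (term n k)) last-row ⟩
    Σₛ (suc n) (term n 0) +ₛ Σₛ m (λ i → Σₛ (suc n) (term n (suc i)))
      ≈⟨ +ₛ-cong first-row (Σₛ-cong m row) ⟩
    firstTerm r +ₛ Σₛ m (λ i → kthTerm r (suc i))
      ≈⟨ +ₛ-congˡ (firstTerm r) (sumₛ-applyUpTo (λ i → kthTerm r (suc i)) (λ x → x) m) ⟨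
    rhs r ∎
    where open SeriesReasoning

lemma1 : (r : ℕ) → 2 ≤ r → f ^ₛ r ≈ₛ rhs r
lemma1 (suc (suc m)) (s≤s (s≤s z≤n)) = ≈ₛ-trans (power-normalForm (suc m)) (MatchStatement.normalForm≈rhs m)
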